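{- Let $n\ge 2$ and $S_n^2=S_n\times K_2$. Then (1) $Kf^*(S_n^2)=\dfrac{48n^3+25n^2-180n+116}{3n+6}$; (2) $\displaystyle\lim_{n\to+\infty}\frac{Kf^*(S_n^2)}{Gut(S_n^2)}=\frac{16}{33}$.
   Context: $S_n$ is the star of order $n$, $K_2$ the complete graph on two vertices, and $S_n\times K_2$ their Cartesian product (vertex set $V(S_n)\times V(K_2)$, with $(u_1,v_1)\sim(u_2,v_2)$ iff ($u_1=u_2$ and $v_1v_2\in E(K_2)$) or ($v_1=v_2$ and $u_1u_2\in E(S_n)$)). For a connected graph $G$ with vertex degrees $d_i$: the resistance distance $r_{ij}$ is the effective resistance between $v_i$ and $v_j$ when every edge is a unit resistor; the multiplicative degree-Kirchhoff index is $Kf^*(G)=\sum_{i<j}d_id_jr_{ij}$; the Gutman index is $Gut(G)=\sum_{i<j}d_id_jd_{ij}$, where $d_{ij}$ is the graph distance between $v_i$ and $v_j$. -}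

module Defs where

open import Data.Bool using (Bool; true; false; _∧_; _∨_; not; if_then_else_)
open import Data.Nat as ℕ using (ℕ; zero; suc)
open import Data.Fin as Fin using (Fin; toℕ; remQuot)
open import Data.Fin.Properties using () renaming (_≟_ to _≟ᶠ_)
open import Data.List using (List; foldr; map; filter; length; allFin)
open import Data.Bool.ListAction using (any)
open import Data.Product using (_×_; _,_; Σ; ∃)
open import Data.Rational as ℚ using (ℚ; 0ℚ; 1ℚ; _+_; _-_; _*_; _÷_; _≟_; ≢-nonZero)
open import Relation.Nullary using (yes; no; does)
open import Relation.Binary.PropositionalEquality using (_≡_)
import Data.Integer

record Graph : Set where
  field
    N   : ℕ
    adj : Fin N → Fin N → Bool
open Graph public

_==_ : ∀ {n} → Fin n → Fin n → Bool
i == j = does (i ≟ᶠ j)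

-- Star S_n of order n: vertex 0 is the centre, vertices 1..n-1 are leaves.
isZero : ∀ {n} → Fin n → Bool
isZero Fin.zero = true
isZero (Fin.suc _) = false

Star : ℕ → Graph
Star n = record { N = n ; adj = λ i j → (isZero i ∧ not (isZero j)) ∨ (isZero j ∧ not (isZero i)) }

K2 : Graph
K2 = record { N = 2 ; adj = λ i j → not (i == j) }

-- Cartesian product G × H; vertex (u , v) is encoded as Fin.combine u v.
_□_ : Graph → Graph → Graph
G □ H = record { N = N G ℕ.* N H ; adj = a }
  where
  a : Fin (N G ℕ.* N H) → Fin (N G ℕ.* N H) → Bool
  a x y with remQuot (N H) x | remQuot (N H) y
  ... | (u₁ , v₁) | (u₂ , v₂) =
        ((u₁ == u₂) ∧ adj H v₁ v₂) ∨ ((v₁ == v₂) ∧ adj G u₁ u₂)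

S²[_] : ℕ → Graph
S²[ n ] = Star n □ K2

sumℚ : ∀ {N} → (Fin N → ℚ) → ℚ
sumℚ {N} f = foldr _+_ 0ℚ (map f (allFin N))

sumℕ : ∀ {N} → (Fin N → ℕ) → ℕ
sumℕ {N} f = foldr ℕ._+_ 0 (map f (allFin N))

deg : (G : Graph) → Fin (N G) → ℕ
deg G i = length (filter (λ j → adj G i j ≟b true) (allFin (N G)))
  where
  open import Data.Bool.Properties using () renaming (_≟_ to _≟b_)

ℕ→ℚ : ℕ → ℚ
ℕ→ℚ n = (Data.Integer.+ n) ℚ./ 1

-- Resistance distance (unit resistors): r is the effective resistance between s and t
-- iff there is a potential φ satisfying Kirchhoff's current law for a unit current
-- injected at s and extracted at t, i.e. (L φ) = e_s - e_t, and r = φ s - φ t.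
δ : ∀ {n} → Fin n → Fin n → ℚ
δ i j = if i == j then 1ℚ else 0ℚ

IsResistance : (G : Graph) → Fin (N G) → Fin (N G) → ℚ → Set
IsResistance G s t r =
  Σ (Fin (N G) → ℚ) λ φ →
    (∀ i → sumℚ (λ j → if adj G i j then φ i - φ j else 0ℚ) ≡ δ i s - δ i t)
    × r ≡ φ s - φ t

IsResistanceFn : (G : Graph) → (Fin (N G) → Fin (N G) → ℚ) → Set
IsResistanceFn G r = ∀ s t → IsResistance G s t (r s t)

KfStar : (G : Graph) → (Fin (N G) → Fin (N G) → ℚ) → ℚ
KfStar G r = sumℚ λ i → sumℚ λ j →
  if toℕ i ℕ.<ᵇ toℕ j then ℕ→ℚ (deg G i ℕ.* deg G j) * r i j else 0ℚ

reach : (G : Graph) → ℕ → Fin (N G) → Fin (N G) → Bool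
reach G zero i j = i == j
reach G (suc k) i j = reach G k i j ∨ any (λ m → reach G k i m ∧ adj G m j) (allFin (N G))

-- least k ≤ bound with reach k i j (returns bound if none found below it)
leastReach : (G : Graph) → ℕ → ℕ → Fin (N G) → Fin (N G) → ℕ
leastReach G k zero i j = k
leastReach G k (suc fuel) i j = if reach G k i j then k else leastReach G (suc k) fuel i j

-- d_ij: shortest-path distance (any shortest path has length < N)
dist : (G : Graph) → Fin (N G) → Fin (N G) → ℕ
dist G i j = leastReach G 0 (N G) i j

Gut : Graph → ℕ
Gut G = sumℕ λ i → sumℕ λ j →
  if toℕ i ℕ.<ᵇ toℕ j then deg G i ℕ.* deg G j ℕ.* dist G i j else 0

-- total division on ℚ (x / 0 := 0); only applied to nonzero denominators here
_÷'_ : ℚ → ℚ → ℚ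
p ÷' q with q ≟ 0ℚ
... | yes _ = 0ℚ
... | no q≢0 = _÷_ p q {{≢-nonZero q≢0}}

ResFn : Graph → Set
ResFn G = Fin (N G) → Fin (N G) → ℚ

module Submission where

-- The prism is grounded at one of its centres. For every source s an explicit potential with
-- denominator 3n + 6 satisfies the Kirchhoff equations of a unit current from s to the ground, and
-- the difference of two such potentials is a potential for any pair s, t; by the Green identity for
-- the graph Laplacian every potential for s, t gives the same effective resistance. Resistance and
-- graph distance are invariant under the automorphisms of the prism, so each is determined by one
-- value per orbit of vertex pairs, and the degree-weighted sums over pairs become polynomials in n;
-- in particular Gut = 33n² - 68n + 36. The ratio Kf*/Gut then differs from 16/33 by a quadratic
-- over a cubic, which is below 1/(n - 1).

open import Defs

module FiniteSums where

  open import Algebra.Bundles using (Monoid)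
  import Algebra.Properties.Monoid.Sum as MonoidSum
  open import Data.Bool using (Bool; true; false; T)
  open import Data.Bool.ListAction using (any)
  open import Data.Empty using (⊥-elim)
  open import Data.Fin using (Fin; zero; suc; combine; _↑ˡ_; _↑ʳ_)
  open import Data.List using (foldr; map; allFin; tabulate)
  import Data.List.Properties as List
  open import Data.List.Membership.Propositional.Properties using (∈-allFin)
  open import Data.List.Relation.Unary.Any as Any using (satisfied)
  open import Data.List.Relation.Unary.Any.Properties using (any⁺; any⁻)
  import Data.Nat as ℕ
  open import Data.Product using (∃)
  open import Data.Unit using (tt)
  import Data.Vec.Functional as Vector
  open import Function using (_∘_; id)
  open import Relation.Binary.PropositionalEquality

  foldr-tabulate : ∀ {a b} {A : Set a} {B : Set b} (_∙_ : A → B → B) (ε : B) {n} (f : Fin n → A) →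
                   foldr _∙_ ε (tabulate f) ≡ Vector.foldr _∙_ ε f
  foldr-tabulate _∙_ ε {ℕ.zero} f = refl
  foldr-tabulate _∙_ ε {ℕ.suc n} f = cong (f zero ∙_) (foldr-tabulate _∙_ ε (f ∘ suc))

  foldr-map-allFin : ∀ {a b} {A : Set a} {B : Set b} (_∙_ : A → B → B) (ε : B) {n} (f : Fin n → A) →
                     foldr _∙_ ε (map f (allFin n)) ≡ Vector.foldr _∙_ ε f
  foldr-map-allFin _∙_ ε {n} f =
    trans (cong (foldr _∙_ ε) (List.map-tabulate id f)) (foldr-tabulate _∙_ ε f)

  any-allFin⁺ : ∀ {n} (p : Fin n → Bool) (i : Fin n) → T (p i) → T (any p (allFin n))
  any-allFin⁺ p i pi = any⁺ p (Any.map (λ { refl → pi }) (∈-allFin i))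

  any-allFin⁻ : ∀ {n} (p : Fin n → Bool) → T (any p (allFin n)) → ∃ λ i → T (p i)
  any-allFin⁻ {n} p h = satisfied (any⁻ p (allFin n) h)

  T-extensional : ∀ {a b} → (T a → T b) → (T b → T a) → a ≡ b
  T-extensional {false} {false} _ _ = refl
  T-extensional {false} {true}  _ g = ⊥-elim (g tt)
  T-extensional {true}  {false} f _ = ⊥-elim (f tt)
  T-extensional {true}  {true}  _ _ = refl

  module _ {a ℓ} (M : Monoid a ℓ) where
    open Monoid M using (Carrier; _≈_; _∙_; ∙-congˡ; assoc; identityˡ)
      renaming (refl to ≈-refl; sym to ≈-sym; trans to ≈-trans)
    open MonoidSum M using (sum; sum-syntax)

    sum-↑ : ∀ m n (f : Vector.Vector Carrier (m ℕ.+ n)) →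
            sum f ≈ sum (f ∘ (_↑ˡ n)) ∙ sum (f ∘ (m ↑ʳ_))
    sum-↑ ℕ.zero n f = ≈-sym (identityˡ _)
    sum-↑ (ℕ.suc m) n f = ≈-trans (∙-congˡ (sum-↑ m n (f ∘ suc))) (≈-sym (assoc _ _ _))

    sum-combine : ∀ m n (f : Vector.Vector Carrier (m ℕ.* n)) →
                  sum f ≈ ∑[ i < m ] ∑[ j < n ] f (combine i j)
    sum-combine ℕ.zero n f = ≈-refl
    sum-combine (ℕ.suc m) n f = ≈-trans (sum-↑ n (m ℕ.* n) f) (∙-congˡ (sum-combine m n (f ∘ (n ↑ʳ_))))

module RationalRingSolver where

  open import Data.Rational using (0ℚ)
  import Data.Rational.Properties as ℚ
  open import Level using (0ℓ)
  open import Relation.Nullary.Decidable using (dec⇒maybe)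
  import Tactic.RingSolver.Core.AlmostCommutativeRing as ACR
  open import Tactic.RingSolver public using (solve-∀)

  ℚ-ring : ACR.AlmostCommutativeRing 0ℓ 0ℓ
  ℚ-ring = ACR.fromCommutativeRing ℚ.+-*-commutativeRing (λ x → dec⇒maybe (0ℚ ℚ.≟ x))

module RationalSums where

  open FiniteSums
  open RationalRingSolver
  open import Algebra.Bundles using (CommutativeRing)
  import Algebra.Properties.Semiring.Sum as SemiringSum
  open import Data.Fin using (Fin; zero; suc)
  import Data.Nat as ℕ
  open import Data.Rational as ℚ using (ℚ; 0ℚ; 1ℚ; _+_; _-_; _*_)
  import Data.Rational.Properties as ℚ
  open import Function using (_∘_)
  open import Relation.Binary.PropositionalEquality

  open SemiringSum (CommutativeRing.semiring ℚ.+-*-commutativeRing) public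
    using (sum; sum-syntax; sum-cong-≗; sum-replicate-zero; ∑-comm; *-distribˡ-sum)

  sumℚ≡sum : ∀ {n} (f : Fin n → ℚ) → sumℚ f ≡ sum f
  sumℚ≡sum = foldr-map-allFin _+_ 0ℚ

  ∑-distrib-sub : ∀ {n} (f g : Fin n → ℚ) → ∑[ i < n ] (f i - g i) ≡ sum f - sum g
  ∑-distrib-sub {ℕ.zero} f g = refl
  ∑-distrib-sub {ℕ.suc n} f g = begin
    (f zero - g zero) + ∑[ i < n ] (f (suc i) - g (suc i))
      ≡⟨ cong ((f zero - g zero) +_) (∑-distrib-sub (f ∘ suc) (g ∘ suc)) ⟩
    (f zero - g zero) + (sum (f ∘ suc) - sum (g ∘ suc))
      ≡⟨ rearrange (f zero) (g zero) (sum (f ∘ suc)) (sum (g ∘ suc)) ⟩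
    (f zero + sum (f ∘ suc)) - (g zero + sum (g ∘ suc)) ∎
    where
    open ≡-Reasoning
    rearrange : ∀ a b c d → (a - b) + (c - d) ≡ (a + c) - (b + d)
    rearrange = solve-∀ ℚ-ring

  sum-δ : ∀ {n} (f : Fin n → ℚ) (s : Fin n) → ∑[ i < n ] (f i * δ i s) ≡ f s
  sum-δ {ℕ.suc n} f zero = begin
    f zero * 1ℚ + ∑[ i < n ] (f (suc i) * 0ℚ) ≡⟨ cong₂ _+_ (ℚ.*-identityʳ (f zero)) (sum-cong-≗ (ℚ.*-zeroʳ ∘ f ∘ suc)) ⟩
    f zero + ∑[ i < n ] 0ℚ                    ≡⟨ cong (f zero +_) (sum-replicate-zero n) ⟩
    f zero + 0ℚ                                 ≡⟨ ℚ.+-identityʳ (f zero) ⟩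
    f zero ∎
    where open ≡-Reasoning
  sum-δ {ℕ.suc n} f (suc s) =
    trans (cong (_+ ∑[ i < n ] (f (suc i) * δ (suc i) (suc s))) (ℚ.*-zeroʳ (f zero)))
          (trans (ℚ.+-identityˡ _) (sum-δ (f ∘ suc) s))

module EffectiveResistance where

  open RationalRingSolver
  open RationalSums
  open import Data.Bool using (true; false; if_then_else_)
  open import Data.Fin using (Fin)
  open import Data.Nat using (ℕ)
  open import Data.Product using (_,_)
  open import Data.Rational using (ℚ; 0ℚ; _-_; _*_)
  import Data.Rational.Properties as ℚ
  open import Relation.Binary.PropositionalEquality

  Symmetric : Graph → Set
  Symmetric G = ∀ i j → adj G i j ≡ adj G j i

  if-sub : ∀ b (x y : ℚ) → (if b then x - y else 0ℚ) ≡ (if b then x else 0ℚ) - (if b then y else 0ℚ)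
  if-sub true  x y = refl
  if-sub false x y = refl

  module _ (G : Graph) where

    private
      V : Set
      V = Fin (N G)
      n : ℕ
      n = N G

    laplacian : (V → ℚ) → V → ℚ
    laplacian f i = sumℚ (λ j → if adj G i j then f i - f j else 0ℚ)

    laplacian-sub : (f g : V → ℚ) (i : V) →
                    laplacian (λ j → f j - g j) i ≡ laplacian f i - laplacian g i
    laplacian-sub f g i = begin
      laplacian (λ j → f j - g j) i                   ≡⟨ sumℚ≡sum (edge (λ j → f j - g j)) ⟩
      sum (edge (λ j → f j - g j))                    ≡⟨ sum-cong-≗ edge-sub ⟩
      ∑[ j < n ] (edge f j - edge g j)                ≡⟨ ∑-distrib-sub (edge f) (edge g) ⟩
      sum (edge f) - sum (edge g)                     ≡˘⟨ cong₂ _-_ (sumℚ≡sum (edge f)) (sumℚ≡sum (edge g)) ⟩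
      laplacian f i - laplacian g i ∎
      where
      open ≡-Reasoning
      edge : (V → ℚ) → V → ℚ
      edge h j = if adj G i j then h i - h j else 0ℚ
      regroup : ∀ a b c d → (a - b) - (c - d) ≡ (a - c) - (b - d)
      regroup = solve-∀ ℚ-ring
      edge-sub : ∀ j → edge (λ j → f j - g j) j ≡ edge f j - edge g j
      edge-sub j = trans (cong (λ x → if adj G i j then x else 0ℚ) (regroup (f i) (g i) (f j) (g j)))
                         (if-sub (adj G i j) _ _)

    private
      diagonal offDiagonal : (V → ℚ) → (V → ℚ) → V → V → ℚ
      diagonal    f g i j = if adj G i j then f i * g i else 0ℚ
      offDiagonal f g i j = if adj G i j then f i * g j else 0ℚ

      ∑∑ : (V → V → ℚ) → ℚ
      ∑∑ h = ∑[ i < n ] ∑[ j < n ] h i j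

    ∑-*-laplacian : (f g : V → ℚ) →
      ∑[ i < n ] (f i * laplacian g i) ≡ ∑∑ (diagonal f g) - ∑∑ (offDiagonal f g)
    ∑-*-laplacian f g = begin
      ∑[ i < n ] (f i * laplacian g i)
        ≡⟨ sum-cong-≗ (λ i → cong (f i *_) (sumℚ≡sum (edge i))) ⟩
      ∑[ i < n ] (f i * sum (edge i))
        ≡⟨ sum-cong-≗ (λ i → *-distribˡ-sum (f i) (edge i)) ⟩
      ∑[ i < n ] ∑[ j < n ] (f i * edge i j)
        ≡⟨ sum-cong-≗ (λ i → sum-cong-≗ (λ j → expand (adj G i j) (f i) (g i) (g j))) ⟩
      ∑[ i < n ] ∑[ j < n ] (diagonal f g i j - offDiagonal f g i j)
        ≡⟨ sum-cong-≗ (λ i → ∑-distrib-sub (diagonal f g i) (offDiagonal f g i)) ⟩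
      ∑[ i < n ] (sum (diagonal f g i) - sum (offDiagonal f g i))
        ≡⟨ ∑-distrib-sub (λ i → sum (diagonal f g i)) (λ i → sum (offDiagonal f g i)) ⟩
      ∑∑ (diagonal f g) - ∑∑ (offDiagonal f g) ∎
      where
      open ≡-Reasoning
      edge : V → V → ℚ
      edge i j = if adj G i j then g i - g j else 0ℚ
      distrib : ∀ x y z → x * (y - z) ≡ x * y - x * z
      distrib = solve-∀ ℚ-ring
      expand : ∀ b x y z → x * (if b then y - z else 0ℚ) ≡
                           (if b then x * y else 0ℚ) - (if b then x * z else 0ℚ)
      expand true  x y z = distrib x y z
      expand false x y z = ℚ.*-zeroʳ x

    green : Symmetric G → (f g : V → ℚ) →
            ∑[ i < n ] (f i * laplacian g i) ≡ ∑[ i < n ] (g i * laplacian f i)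
    green sym-adj f g = begin
      ∑[ i < n ] (f i * laplacian g i)            ≡⟨ ∑-*-laplacian f g ⟩
      ∑∑ (diagonal f g) - ∑∑ (offDiagonal f g)    ≡⟨ cong₂ _-_ diagonal-comm offDiagonal-comm ⟩
      ∑∑ (diagonal g f) - ∑∑ (offDiagonal g f)    ≡˘⟨ ∑-*-laplacian g f ⟩
      ∑[ i < n ] (g i * laplacian f i) ∎
      where
      open ≡-Reasoning
      if-cong : ∀ b {x y : ℚ} → x ≡ y → (if b then x else 0ℚ) ≡ (if b then y else 0ℚ)
      if-cong b refl = refl
      diagonal-comm : ∑∑ (diagonal f g) ≡ ∑∑ (diagonal g f)
      diagonal-comm = sum-cong-≗ λ i → sum-cong-≗ λ j → if-cong (adj G i j) (ℚ.*-comm (f i) (g i))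
      offDiagonal-comm : ∑∑ (offDiagonal f g) ≡ ∑∑ (offDiagonal g f)
      offDiagonal-comm = trans (∑-comm (offDiagonal f g)) (sum-cong-≗ λ j → sum-cong-≗ λ i →
        trans (cong (λ b → if b then f i * g j else 0ℚ) (sym-adj i j)) (if-cong (adj G j i) (ℚ.*-comm (f i) (g j))))

    resistance-unique : Symmetric G → ∀ {s t r r′} → IsResistance G s t r → IsResistance G s t r′ → r ≡ r′
    resistance-unique sym-adj {s} {t} (φ , Lφ , refl) (ψ , Lψ , refl) = begin
      φ s - φ t                                ≡˘⟨ pair φ ⟩
      ∑[ i < n ] (φ i * (δ i s - δ i t))       ≡˘⟨ sum-cong-≗ (λ i → cong (φ i *_) (Lψ i)) ⟩
      ∑[ i < n ] (φ i * laplacian ψ i)         ≡⟨ green sym-adj φ ψ ⟩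
      ∑[ i < n ] (ψ i * laplacian φ i)         ≡⟨ sum-cong-≗ (λ i → cong (ψ i *_) (Lφ i)) ⟩
      ∑[ i < n ] (ψ i * (δ i s - δ i t))       ≡⟨ pair ψ ⟩
      ψ s - ψ t ∎
      where
      open ≡-Reasoning
      pair : ∀ f → ∑[ i < n ] (f i * (δ i s - δ i t)) ≡ f s - f t
      pair f = begin
        ∑[ i < n ] (f i * (δ i s - δ i t))          ≡⟨ sum-cong-≗ (λ i → distrib (f i) (δ i s) (δ i t)) ⟩
        ∑[ i < n ] (f i * δ i s - f i * δ i t)      ≡⟨ ∑-distrib-sub (λ i → f i * δ i s) (λ i → f i * δ i t) ⟩
        ∑[ i < n ] (f i * δ i s) - ∑[ i < n ] (f i * δ i t) ≡⟨ cong₂ _-_ (sum-δ f s) (sum-δ f t) ⟩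
        f s - f t ∎
        where
        distrib : ∀ x a b → x * (a - b) ≡ x * a - x * b
        distrib = solve-∀ ℚ-ring

    resistance-from-grounded : (c : V) (ψ : V → V → ℚ) →
      (∀ s i → laplacian (ψ s) i ≡ δ i s - δ i c) →
      ∀ s t → IsResistance G s t ((ψ s s - ψ t s) - (ψ s t - ψ t t))
    resistance-from-grounded c ψ Lψ s t = (λ i → ψ s i - ψ t i) , harmonic , refl
      where
      harmonic : ∀ i → laplacian (λ j → ψ s j - ψ t j) i ≡ δ i s - δ i t
      harmonic i = begin
        laplacian (λ j → ψ s j - ψ t j) i      ≡⟨ laplacian-sub (ψ s) (ψ t) i ⟩
        laplacian (ψ s) i - laplacian (ψ t) i  ≡⟨ cong₂ _-_ (Lψ s i) (Lψ t i) ⟩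
        (δ i s - δ i c) - (δ i t - δ i c)      ≡⟨ cancel (δ i s) (δ i t) (δ i c) ⟩
        δ i s - δ i t ∎
        where
        open ≡-Reasoning
        cancel : ∀ a b c → (a - c) - (b - c) ≡ a - b
        cancel = solve-∀ ℚ-ring

module NaturalSums where

  open FiniteSums
  import Algebra.Properties.Semiring.Sum as SemiringSum
  open import Data.Bool using (true; false; if_then_else_)
  open import Data.Fin using (Fin; toℕ)
  import Data.Fin.Properties as Fin
  open import Data.Nat as ℕ using (ℕ; _+_; _*_; _<_; _<ᵇ_)
  import Data.Nat.Properties as ℕ
  open import Data.Empty using (⊥-elim)
  open import Data.Unit using (tt)
  open import Function using (_∘_; _$_)
  open import Relation.Binary.Definitions using (tri<; tri≈; tri>)
  open import Relation.Binary.PropositionalEquality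
  open import Relation.Nullary using (¬_)

  open SemiringSum ℕ.+-*-semiring public using (sum; sum-syntax; sum-cong-≗; sum-replicate-zero; ∑-distrib-+; ∑-comm)

  sumℕ≡sum : ∀ {n} (f : Fin n → ℕ) → sumℕ f ≡ sum f
  sumℕ≡sum = foldr-map-allFin _+_ 0

  ∑-upper-triangle : ∀ {n} (h : Fin n → Fin n → ℕ) → (∀ i j → h i j ≡ h j i) → (∀ i → h i i ≡ 0) →
    2 * ∑[ i < n ] ∑[ j < n ] (if toℕ i <ᵇ toℕ j then h i j else 0) ≡ ∑[ i < n ] ∑[ j < n ] h i j
  ∑-upper-triangle {n} h h-sym h-diag = sym $ begin
    ∑[ i < n ] ∑[ j < n ] h i j                             ≡⟨ sum-cong-≗ (λ i → sum-cong-≗ (split i)) ⟩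
    ∑[ i < n ] ∑[ j < n ] (upper i j + upper j i)           ≡⟨ sum-cong-≗ (λ i → ∑-distrib-+ (upper i) (λ j → upper j i)) ⟩
    ∑[ i < n ] (sum (upper i) + ∑[ j < n ] upper j i)       ≡⟨ ∑-distrib-+ (sum ∘ upper) (λ i → ∑[ j < n ] upper j i) ⟩
    U + ∑[ i < n ] ∑[ j < n ] upper j i                     ≡⟨ cong (U +_) (∑-comm (λ i j → upper j i)) ⟩
    U + U                                                   ≡˘⟨ cong (U +_) (ℕ.+-identityʳ U) ⟩
    2 * U ∎
    where
    open ≡-Reasoning
    upper : Fin n → Fin n → ℕ
    upper i j = if toℕ i <ᵇ toℕ j then h i j else 0
    U : ℕ
    U = ∑[ i < n ] sum (upper i)
    false-if : ∀ {m k} → ¬ m < k → (m <ᵇ k) ≡ false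
    false-if m≮k = T-extensional (⊥-elim ∘ m≮k ∘ ℕ.<ᵇ⇒< _ _) (λ ())
    true-if : ∀ {m k} → m < k → (m <ᵇ k) ≡ true
    true-if m<k = T-extensional (λ _ → tt) (λ _ → ℕ.<⇒<ᵇ m<k)
    split : ∀ i j → h i j ≡ upper i j + upper j i
    split i j with ℕ.<-cmp (toℕ i) (toℕ j)
    ... | tri< i<j _ j≮i rewrite true-if i<j | false-if j≮i = sym (ℕ.+-identityʳ (h i j))
    ... | tri> i≮j _ j<i rewrite false-if i≮j | true-if j<i = h-sym i j
    ... | tri≈ i≮j i≡j _ rewrite Fin.toℕ-injective i≡j | false-if i≮j = h-diag j

module GraphDistance where

  open FiniteSums
  open import Data.Bool using (Bool; true; false; T; _∧_; _∨_)
  open import Data.Bool.ListAction using (any)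
  import Data.Bool.Properties as Bool
  open import Data.Empty using (⊥-elim)
  open import Data.Fin as Fin using (Fin)
  open import Data.List using (allFin)
  open import Data.Nat as ℕ using (ℕ; zero; suc; _+_; _≤_; _<_; _≤ᵇ_; z≤n; s≤s)
  import Data.Nat.Properties as ℕ
  open import Data.Product using (∃; _×_; _,_)
  open import Data.Sum using (inj₁; inj₂)
  open import Data.Unit using (tt)
  open import Function.Bundles using (Equivalence)
  open import Relation.Binary.PropositionalEquality
  open import Relation.Nullary using (yes; no)

  module _ (G : Graph) (d : Fin (N G) → Fin (N G) → ℕ)
    (d-refl : ∀ x → d x x ≡ 0)
    (d-zero : ∀ {x y} → d x y ≡ 0 → x ≡ y)
    (d-edge : ∀ x {y z} → T (adj G z y) → d x y ≤ suc (d x z))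
    (d-step : ∀ x y → 0 < d x y → ∃ λ z → T (adj G z y) × suc (d x z) ≡ d x y)
    where

    reach≡≤ᵇ : ∀ k x y → reach G k x y ≡ (d x y ≤ᵇ k)
    reach≡≤ᵇ zero x y with x Fin.≟ y
    ... | yes refl rewrite d-refl x = refl
    ... | no x≢y = sym (T-extensional (λ d≤0 → ⊥-elim (x≢y (d-zero (ℕ.n≤0⇒n≡0 (ℕ.≤ᵇ⇒≤ _ 0 d≤0))))) λ ())
    reach≡≤ᵇ (suc k) x y = T-extensional to from
      where
      via : ∀ z → Bool
      via z = reach G k x z ∧ adj G z y
      to : T (reach G k x y ∨ any via (allFin (N G))) → T (d x y ≤ᵇ suc k)
      to h with Equivalence.to Bool.T-∨ h
      ... | inj₁ reach-y = ℕ.≤⇒≤ᵇ {d x y} (ℕ.m≤n⇒m≤1+n (ℕ.≤ᵇ⇒≤ _ k (subst T (reach≡≤ᵇ k x y) reach-y)))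
      ... | inj₂ reach-via with any-allFin⁻ via reach-via
      ...   | z , via-z with Equivalence.to Bool.T-∧ via-z
      ...     | reach-z , z~y = ℕ.≤⇒≤ᵇ {d x y} (ℕ.≤-trans (d-edge x z~y)
                                   (s≤s (ℕ.≤ᵇ⇒≤ _ k (subst T (reach≡≤ᵇ k x z) reach-z))))
      from : T (d x y ≤ᵇ suc k) → T (reach G k x y ∨ any via (allFin (N G)))
      from h with d x y ℕ.≤? k
      ... | yes d≤k = Equivalence.from Bool.T-∨ (inj₁ (subst T (sym (reach≡≤ᵇ k x y)) (ℕ.≤⇒≤ᵇ d≤k)))
      ... | no d≰k with d-step x y (ℕ.≤-<-trans z≤n (ℕ.≰⇒> d≰k))
      ...   | z , z~y , dz+1≡d = Equivalence.from Bool.T-∨ (inj₂ (any-allFin⁺ via z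
                (Equivalence.from Bool.T-∧ (subst T (sym (reach≡≤ᵇ k x z)) (ℕ.≤⇒≤ᵇ dz≤k) , z~y))))
        where
        d≡k+1 : d x y ≡ suc k
        d≡k+1 = ℕ.≤-antisym (ℕ.≤ᵇ⇒≤ _ (suc k) h) (ℕ.≰⇒> d≰k)
        dz≤k : d x z ≤ k
        dz≤k = ℕ.≤-reflexive (ℕ.suc-injective (trans dz+1≡d d≡k+1))

    leastReach≡ : ∀ k fuel x y → k ≤ d x y → d x y < k + fuel → leastReach G k fuel x y ≡ d x y
    leastReach≡ k zero x y k≤d d<k = ⊥-elim (ℕ.<-irrefl refl (ℕ.≤-<-trans k≤d (subst (d x y <_) (ℕ.+-identityʳ k) d<k)))
    leastReach≡ k (suc fuel) x y k≤d d<k+fuel rewrite reach≡≤ᵇ k x y with d x y ≤ᵇ k in d≤ᵇk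
    ... | true  = ℕ.≤-antisym k≤d (ℕ.≤ᵇ⇒≤ _ k (subst T (sym d≤ᵇk) tt))
    ... | false = leastReach≡ (suc k) fuel x y k<d (subst (d x y <_) (ℕ.+-suc k fuel) d<k+fuel)
      where
      k<d : k < d x y
      k<d = ℕ.≰⇒> (λ d≤k → subst T d≤ᵇk (ℕ.≤⇒≤ᵇ d≤k))

    dist≡ : ∀ x y → d x y < N G → dist G x y ≡ d x y
    dist≡ x y = leastReach≡ 0 (N G) x y z≤n

module Prism where

  open FiniteSums
  open NaturalSums
  open import Data.Bool using (Bool; true; false; T; if_then_else_; _∧_; _∨_)
  import Data.Bool.Properties as Bool
  open import Data.Fin as Fin using (Fin; zero; suc; remQuot; combine)
  import Data.Fin.Properties as Fin
  open import Data.Fin.Patterns using (0F; 1F)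
  open import Data.List using (List; []; _∷_; foldr; map; filter; length; allFin)
  open import Data.Nat as ℕ using (ℕ; zero; suc; _+_; _*_)
  import Data.Nat.Properties as ℕ
  open import Data.Nat.Tactic.RingSolver using (solve)
  open import Data.Product using (_×_; _,_; uncurry)
  open import Data.Unit using (tt)
  open import Function using (_∘_)
  open import Function.Bundles using (Equivalence)
  open import Relation.Binary.PropositionalEquality
  open import Relation.Nullary using (yes)
  open import Relation.Nullary.Decidable using (dec-true; dec-false)

  pattern centre = zero
  pattern leaf w = suc w

  Vertex : ℕ → Set
  Vertex m = Fin (suc m) × Fin 2

  decode : ∀ {m} → Fin (N S²[ suc m ]) → Vertex m
  decode {m} = remQuot {suc m} 2

  other : Fin 2 → Fin 2
  other 0F = 1F
  other 1F = 0F

  ==-refl : ∀ {n} (i : Fin n) → (i == i) ≡ true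
  ==-refl i = dec-true (i Fin.≟ i) refl

  ==-no : ∀ {n} {i j : Fin n} → i ≢ j → (i == j) ≡ false
  ==-no {i = i} {j} = dec-false (i Fin.≟ j)

  ==-sym : ∀ {n} (i j : Fin n) → (i == j) ≡ (j == i)
  ==-sym zero    zero    = refl
  ==-sym zero    (suc j) = refl
  ==-sym (suc i) zero    = refl
  ==-sym (suc i) (suc j) = ==-sym i j

  ==⇒≡ : ∀ {n} {i j : Fin n} → T (i == j) → i ≡ j
  ==⇒≡ {i = i} {j} t with i Fin.≟ j
  ... | yes i≡j = i≡j

  ≡⇒== : ∀ {n} {i j : Fin n} → i ≡ j → T (i == j)
  ≡⇒== {i = i} refl rewrite ==-refl i = tt

  _==ᵛ_ : ∀ {m} → Vertex m → Vertex m → Bool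
  (u , v) ==ᵛ (u′ , v′) = (u == u′) ∧ (v == v′)

  ==ᵛ⇒≡ : ∀ {m} {p q : Vertex m} → T (p ==ᵛ q) → p ≡ q
  ==ᵛ⇒≡ t = let u≡u′ , v≡v′ = Equivalence.to Bool.T-∧ t in cong₂ _,_ (==⇒≡ u≡u′) (==⇒≡ v≡v′)

  ==ᵛ-refl : ∀ {m} (p : Vertex m) → T (p ==ᵛ p)
  ==ᵛ-refl (u , v) rewrite ==-refl u | ==-refl v = tt

  decode-injective : ∀ {m} {x y : Fin (N S²[ suc m ])} → decode {m} x ≡ decode y → x ≡ y
  decode-injective {m} {x} {y} e =
    trans (sym (Fin.combine-remQuot {suc m} 2 x)) (trans (cong (uncurry combine) e) (Fin.combine-remQuot {suc m} 2 y))

  ==-decode : ∀ {m} (x y : Fin (N S²[ suc m ])) → (x == y) ≡ (decode {m} x ==ᵛ decode y)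
  ==-decode {m} x y = T-extensional
    (λ x==y → subst (λ z → T (decode {m} x ==ᵛ decode z)) (==⇒≡ {i = x} x==y) (==ᵛ-refl (decode {m} x)))
    (λ dx==dy → ≡⇒== {i = x} {y} (decode-injective {m} (==ᵛ⇒≡ {p = decode {m} x} {decode y} dx==dy)))

  star-symmetric : ∀ {n} (u u′ : Fin n) → adj (Star n) u u′ ≡ adj (Star n) u′ u
  star-symmetric zero    zero    = refl
  star-symmetric zero    (suc _) = refl
  star-symmetric (suc _) zero    = refl
  star-symmetric (suc _) (suc _) = refl

  adjacent : ∀ {m} → Vertex m → Vertex m → Bool
  adjacent {m} (u₁ , v₁) (u₂ , v₂) = ((u₁ == u₂) ∧ adj K2 v₁ v₂) ∨ ((v₁ == v₂) ∧ adj (Star (suc m)) u₁ u₂)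

  adjacent-symmetric : ∀ {m} (p q : Vertex m) → adjacent p q ≡ adjacent q p
  adjacent-symmetric (u , v) (u′ , v′) rewrite ==-sym u u′ | ==-sym v v′ | star-symmetric u u′ = refl

  prism-symmetric : ∀ m (x y : Fin (N S²[ suc m ])) → adj S²[ suc m ] x y ≡ adj S²[ suc m ] y x
  prism-symmetric m x y = adjacent-symmetric (decode {m} x) (decode y)

  ∑ᵛ : ∀ {m} → (Vertex m → ℕ) → ℕ
  ∑ᵛ {m} g = ∑[ u < suc m ] ∑[ v < 2 ] g (u , v)

  sum-decode : ∀ {m} (g : Vertex m → ℕ) → sum (g ∘ decode) ≡ ∑ᵛ g
  sum-decode {m} g = trans (sum-combine ℕ.+-0-monoid (suc m) 2 (g ∘ decode))
    (sum-cong-≗ λ u → sum-cong-≗ λ v → cong g (Fin.remQuot-combine u v))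

  ∑-const : ∀ m c → ∑[ i < m ] c ≡ m * c
  ∑-const zero    c = refl
  ∑-const (suc m) c = cong (c +_) (∑-const m c)

  sum-== : ∀ {m} (i : Fin m) (f : Fin m → ℕ) → ∑[ w < m ] (if i == w then f w else 0) ≡ f i
  sum-== {suc m} zero f = trans (cong (f zero +_) (sum-replicate-zero m)) (ℕ.+-identityʳ (f zero))
  sum-== {suc m} (suc i) f = sum-== i (f ∘ suc)

  ∑-count : ∀ {k} (i : Fin (suc k)) A B → ∑[ w < suc k ] (if i == w then A else B) ≡ A + k * B
  ∑-count {k} zero A B = cong (A +_) (∑-const k B)
  ∑-count {suc k} (suc i) A B = begin
    B + ∑[ w < suc k ] (if i == w then A else B) ≡⟨ cong (B +_) (∑-count i A B) ⟩
    B + (A + k * B)                              ≡⟨ solve (A ∷ B ∷ k ∷ []) ⟩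
    A + (B + k * B) ∎
    where open ≡-Reasoning

  neighbourSum : ∀ {m} → (Vertex m → ℕ) → Vertex m → ℕ
  neighbourSum {m} g (centre , v) = g (centre , other v) + ∑[ w < m ] g (leaf w , v)
  neighbourSum     g (leaf w , v) = g (centre , v) + g (leaf w , other v)

  sum-neighbours : ∀ {m} (g : Vertex m → ℕ) (x : Fin (N S²[ suc m ])) →
    sum (λ j → if adj S²[ suc m ] x j then g (decode j) else 0) ≡ neighbourSum g (decode x)
  sum-neighbours {m} g x = trans (sum-decode (λ p → if adjacent (decode x) p then g p else 0)) (neighbours (decode x))
    where
    neighbours : ∀ p → ∑ᵛ (λ q → if adjacent p q then g q else 0) ≡ neighbourSum g p
    neighbours (centre , 0F) =
      cong₂ _+_ (ℕ.+-identityʳ (g (centre , 1F))) (sum-cong-≗ λ w → ℕ.+-identityʳ (g (leaf w , 0F)))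
    neighbours (centre , 1F) =
      cong₂ _+_ (ℕ.+-identityʳ (g (centre , 0F))) (sum-cong-≗ λ w → ℕ.+-identityʳ (g (leaf w , 1F)))
    neighbours (leaf i , 0F) =
      cong₂ _+_ (ℕ.+-identityʳ (g (centre , 0F))) (trans (sum-cong-≗ rung) (sum-== i (λ w → g (leaf w , 1F))))
      where
      rung : ∀ w → (if (i == w) ∧ false ∨ false then g (leaf w , 0F) else 0) +
                   ((if (i == w) ∧ true ∨ false then g (leaf w , 1F) else 0) + 0) ≡
                   (if i == w then g (leaf w , 1F) else 0)
      rung w with i == w
      ... | true  = ℕ.+-identityʳ _
      ... | false = refl
    neighbours (leaf i , 1F) =
      cong₂ _+_ (ℕ.+-identityʳ (g (centre , 1F))) (trans (sum-cong-≗ rung) (sum-== i (λ w → g (leaf w , 0F))))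
      where
      rung : ∀ w → (if (i == w) ∧ true ∨ false then g (leaf w , 0F) else 0) +
                   ((if (i == w) ∧ false ∨ false then g (leaf w , 1F) else 0) + 0) ≡
                   (if i == w then g (leaf w , 0F) else 0)
      rung w with i == w
      ... | true  = ℕ.+-identityʳ _
      ... | false = refl

  degree : ∀ {m} → Vertex m → ℕ
  degree {m} (centre , _) = suc m
  degree     (leaf _ , _) = 2

  neighbourSum-const : ∀ {m} c (p : Vertex m) → neighbourSum (λ _ → c) p ≡ degree p * c
  neighbourSum-const {m} c (centre , v) = cong (c +_) (∑-const m c)
  neighbourSum-const     c (leaf w , v) = cong (c +_) (sym (ℕ.+-identityʳ c))

  length-filter : ∀ {a} {A : Set a} (b : A → Bool) (xs : List A) →
    length (filter (λ j → b j Bool.≟ true) xs) ≡ foldr _+_ 0 (map (λ j → if b j then 1 else 0) xs)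
  length-filter b [] = refl
  length-filter b (x ∷ xs) with b x
  ... | true  = cong suc (length-filter b xs)
  ... | false = length-filter b xs

  deg-decode : ∀ m (x : Fin (N S²[ suc m ])) → deg S²[ suc m ] x ≡ degree (decode {m} x)
  deg-decode m x = begin
    deg S²[ suc m ] x                                       ≡⟨ length-filter (adj S²[ suc m ] x) (allFin (N S²[ suc m ])) ⟩
    sumℕ (λ j → if adj S²[ suc m ] x j then 1 else 0)       ≡⟨ sumℕ≡sum (λ j → if adj S²[ suc m ] x j then 1 else 0) ⟩
    sum (λ j → if adj S²[ suc m ] x j then 1 else 0)        ≡⟨ sum-neighbours {m} (λ _ → 1) x ⟩
    neighbourSum (λ _ → 1) (decode {m} x)                       ≡⟨ neighbourSum-const 1 (decode {m} x) ⟩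
    degree (decode {m} x) * 1                                   ≡⟨ ℕ.*-identityʳ (degree (decode {m} x)) ⟩
    degree (decode {m} x) ∎
    where open ≡-Reasoning

module Orbits where

  open NaturalSums
  open Prism
  open import Data.Bool using (true; false; if_then_else_)
  open import Data.Fin using (Fin; toℕ)
  open import Data.Fin.Patterns using (0F; 1F)
  open import Data.Nat as ℕ using (ℕ; suc; _+_; _*_; _<ᵇ_)
  import Data.Nat.Properties as ℕ
  open import Data.Nat.Tactic.RingSolver using (solve-∀)
  open import Data.Product using (_,_)
  open import Function using (_∘_)
  open import Relation.Binary.PropositionalEquality

  -- A function of vertex pairs that is invariant under the automorphisms of the prism, given by its
  -- value on each orbit: α on the two centres, β on a centre and a leaf of the same layer, γ on a
  -- centre and a leaf of the other layer, δ on a leaf and its copy, ε on two leaves of one layer and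
  -- ζ on two leaves of different layers.
  orbitwise : ∀ {m} → (α β γ δ ε ζ : ℕ) → Vertex m → Vertex m → ℕ
  orbitwise α β γ δ ε ζ (centre , 0F) (centre , 0F) = 0
  orbitwise α β γ δ ε ζ (centre , 0F) (centre , 1F) = α
  orbitwise α β γ δ ε ζ (centre , 1F) (centre , 0F) = α
  orbitwise α β γ δ ε ζ (centre , 1F) (centre , 1F) = 0
  orbitwise α β γ δ ε ζ (centre , 0F) (leaf _ , 0F) = β
  orbitwise α β γ δ ε ζ (centre , 0F) (leaf _ , 1F) = γ
  orbitwise α β γ δ ε ζ (centre , 1F) (leaf _ , 0F) = γ
  orbitwise α β γ δ ε ζ (centre , 1F) (leaf _ , 1F) = β
  orbitwise α β γ δ ε ζ (leaf _ , 0F) (centre , 0F) = β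
  orbitwise α β γ δ ε ζ (leaf _ , 0F) (centre , 1F) = γ
  orbitwise α β γ δ ε ζ (leaf _ , 1F) (centre , 0F) = γ
  orbitwise α β γ δ ε ζ (leaf _ , 1F) (centre , 1F) = β
  orbitwise α β γ δ ε ζ (leaf i , 0F) (leaf w , 0F) = if i == w then 0 else ε
  orbitwise α β γ δ ε ζ (leaf i , 0F) (leaf w , 1F) = if i == w then δ else ζ
  orbitwise α β γ δ ε ζ (leaf i , 1F) (leaf w , 0F) = if i == w then δ else ζ
  orbitwise α β γ δ ε ζ (leaf i , 1F) (leaf w , 1F) = if i == w then 0 else ε

  module _ {m : ℕ} (α β γ δ ε ζ : ℕ) where

    private
      f : Vertex m → Vertex m → ℕ
      f = orbitwise α β γ δ ε ζ

    orbitwise-symmetric : ∀ p q → f p q ≡ f q p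
    orbitwise-symmetric (centre , 0F) (centre , 0F) = refl
    orbitwise-symmetric (centre , 0F) (centre , 1F) = refl
    orbitwise-symmetric (centre , 1F) (centre , 0F) = refl
    orbitwise-symmetric (centre , 1F) (centre , 1F) = refl
    orbitwise-symmetric (centre , 0F) (leaf _ , 0F) = refl
    orbitwise-symmetric (centre , 0F) (leaf _ , 1F) = refl
    orbitwise-symmetric (centre , 1F) (leaf _ , 0F) = refl
    orbitwise-symmetric (centre , 1F) (leaf _ , 1F) = refl
    orbitwise-symmetric (leaf _ , 0F) (centre , 0F) = refl
    orbitwise-symmetric (leaf _ , 0F) (centre , 1F) = refl
    orbitwise-symmetric (leaf _ , 1F) (centre , 0F) = refl
    orbitwise-symmetric (leaf _ , 1F) (centre , 1F) = refl
    orbitwise-symmetric (leaf i , 0F) (leaf w , 0F) rewrite ==-sym i w = refl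
    orbitwise-symmetric (leaf i , 0F) (leaf w , 1F) rewrite ==-sym i w = refl
    orbitwise-symmetric (leaf i , 1F) (leaf w , 0F) rewrite ==-sym i w = refl
    orbitwise-symmetric (leaf i , 1F) (leaf w , 1F) rewrite ==-sym i w = refl

    orbitwise-diagonal : ∀ p → f p p ≡ 0
    orbitwise-diagonal (centre , 0F) = refl
    orbitwise-diagonal (centre , 1F) = refl
    orbitwise-diagonal (leaf i , 0F) rewrite ==-refl i = refl
    orbitwise-diagonal (leaf i , 1F) rewrite ==-refl i = refl

  orbitTotal : ℕ → (α β γ δ ε ζ : ℕ) → ℕ
  orbitTotal k α β γ δ ε ζ = n * n * α + 4 * n * m * (β + γ) + 4 * m * δ + 4 * m * k * (ε + ζ)
    where
    m n : ℕ
    m = suc k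
    n = suc m

  module _ (k : ℕ) (α β γ δ ε ζ : ℕ) where

    private
      m n : ℕ
      m = suc k
      n = suc m

      weight : Vertex m → Vertex m → ℕ
      weight p q = degree p * degree q * orbitwise α β γ δ ε ζ p q

      centreRow leafRow : ℕ
      centreRow = n * n * α + m * (2 * n * (β + γ))
      leafRow   = 2 * n * (β + γ) + (4 * δ + k * (4 * (ε + ζ)))

    centre-row : ∀ v → ∑ᵛ (weight (centre , v)) ≡ centreRow
    centre-row 0F = begin
      (n * n * 0 + (n * n * α + 0)) + ∑[ w < m ] (n * 2 * β + (n * 2 * γ + 0))
        ≡⟨ cong (n * n * 0 + (n * n * α + 0) +_) (∑-const m (n * 2 * β + (n * 2 * γ + 0))) ⟩
      (n * n * 0 + (n * n * α + 0)) + m * (n * 2 * β + (n * 2 * γ + 0))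
        ≡⟨ regroup n m α β γ ⟩
      centreRow ∎
      where
      open ≡-Reasoning
      regroup : ∀ n m α β γ → (n * n * 0 + (n * n * α + 0)) + m * (n * 2 * β + (n * 2 * γ + 0)) ≡
                              n * n * α + m * (2 * n * (β + γ))
      regroup = solve-∀
    centre-row 1F = begin
      (n * n * α + (n * n * 0 + 0)) + ∑[ w < m ] (n * 2 * γ + (n * 2 * β + 0))
        ≡⟨ cong (n * n * α + (n * n * 0 + 0) +_) (∑-const m (n * 2 * γ + (n * 2 * β + 0))) ⟩
      (n * n * α + (n * n * 0 + 0)) + m * (n * 2 * γ + (n * 2 * β + 0))
        ≡⟨ regroup n m α β γ ⟩
      centreRow ∎
      where
      open ≡-Reasoning
      regroup : ∀ n m α β γ → (n * n * α + (n * n * 0 + 0)) + m * (n * 2 * γ + (n * 2 * β + 0)) ≡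
                              n * n * α + m * (2 * n * (β + γ))
      regroup = solve-∀

    leaf-row : ∀ i v → ∑ᵛ (weight (leaf i , v)) ≡ leafRow
    leaf-row i 0F = begin
      (2 * n * β + (2 * n * γ + 0)) + ∑[ w < m ] (4 * (if i == w then 0 else ε) + (4 * (if i == w then δ else ζ) + 0))
        ≡⟨ cong (2 * n * β + (2 * n * γ + 0) +_) (trans (sum-cong-≗ (collapse ∘ (i ==_))) (∑-count i (4 * δ) (4 * (ε + ζ)))) ⟩
      (2 * n * β + (2 * n * γ + 0)) + (4 * δ + k * (4 * (ε + ζ)))
        ≡⟨ cong (_+ (4 * δ + k * (4 * (ε + ζ)))) (regroup n β γ) ⟩
      leafRow ∎
      where
      open ≡-Reasoning
      regroup : ∀ n β γ → 2 * n * β + (2 * n * γ + 0) ≡ 2 * n * (β + γ)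
      regroup = solve-∀
      collapse : ∀ b → 4 * (if b then 0 else ε) + (4 * (if b then δ else ζ) + 0) ≡ (if b then 4 * δ else 4 * (ε + ζ))
      collapse true  = ℕ.+-identityʳ (4 * δ)
      collapse false = trans (cong (4 * ε +_) (ℕ.+-identityʳ (4 * ζ))) (sym (ℕ.*-distribˡ-+ 4 ε ζ))
    leaf-row i 1F = begin
      (2 * n * γ + (2 * n * β + 0)) + ∑[ w < m ] (4 * (if i == w then δ else ζ) + (4 * (if i == w then 0 else ε) + 0))
        ≡⟨ cong (2 * n * γ + (2 * n * β + 0) +_) (trans (sum-cong-≗ (collapse ∘ (i ==_))) (∑-count i (4 * δ) (4 * (ε + ζ)))) ⟩
      (2 * n * γ + (2 * n * β + 0)) + (4 * δ + k * (4 * (ε + ζ)))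
        ≡⟨ cong (_+ (4 * δ + k * (4 * (ε + ζ)))) (regroup n β γ) ⟩
      leafRow ∎
      where
      open ≡-Reasoning
      regroup : ∀ n β γ → 2 * n * γ + (2 * n * β + 0) ≡ 2 * n * (β + γ)
      regroup = solve-∀
      collapse : ∀ b → 4 * (if b then δ else ζ) + (4 * (if b then 0 else ε) + 0) ≡ (if b then 4 * δ else 4 * (ε + ζ))
      collapse true  = ℕ.+-identityʳ (4 * δ)
      collapse false = trans (cong (4 * ζ +_) (ℕ.+-identityʳ (4 * ε)))
                             (trans (ℕ.+-comm (4 * ζ) (4 * ε)) (sym (ℕ.*-distribˡ-+ 4 ε ζ)))

    ∑ᵛ-weight : ∑ᵛ (λ p → ∑ᵛ (weight p)) ≡ 2 * orbitTotal k α β γ δ ε ζ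
    ∑ᵛ-weight = begin
      (∑ᵛ (weight (centre , 0F)) + (∑ᵛ (weight (centre , 1F)) + 0)) +
      ∑[ w < m ] (∑ᵛ (weight (leaf w , 0F)) + (∑ᵛ (weight (leaf w , 1F)) + 0))
        ≡⟨ cong₂ _+_ (cong₂ (λ a b → a + (b + 0)) (centre-row 0F) (centre-row 1F))
                     (trans (sum-cong-≗ λ w → cong₂ (λ a b → a + (b + 0)) (leaf-row w 0F) (leaf-row w 1F))
                            (∑-const m (leafRow + (leafRow + 0)))) ⟩
      (centreRow + (centreRow + 0)) + m * (leafRow + (leafRow + 0))
        ≡⟨ total k α β γ δ ε ζ ⟩
      2 * orbitTotal k α β γ δ ε ζ ∎
      where
      open ≡-Reasoning
      total : ∀ k α β γ δ ε ζ → let m = suc k; n = suc m in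
        ((n * n * α + m * (2 * n * (β + γ))) + ((n * n * α + m * (2 * n * (β + γ))) + 0)) +
        m * ((2 * n * (β + γ) + (4 * δ + k * (4 * (ε + ζ)))) + ((2 * n * (β + γ) + (4 * δ + k * (4 * (ε + ζ)))) + 0))
        ≡ 2 * (n * n * α + 4 * n * m * (β + γ) + 4 * m * δ + 4 * m * k * (ε + ζ))
      total = solve-∀

    upper-orbit-sum :
      ∑[ i < N S²[ n ] ] ∑[ j < N S²[ n ] ]
        (if toℕ i <ᵇ toℕ j then deg S²[ n ] i * deg S²[ n ] j * orbitwise α β γ δ ε ζ (decode {m} i) (decode {m} j) else 0)
      ≡ orbitTotal k α β γ δ ε ζ
    upper-orbit-sum = ℕ.*-cancelˡ-≡ _ _ 2 (begin
      2 * ∑[ i < N S²[ n ] ] ∑[ j < N S²[ n ] ] (if toℕ i <ᵇ toℕ j then h i j else 0)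
        ≡⟨ ∑-upper-triangle h h-symmetric h-diagonal ⟩
      ∑[ i < N S²[ n ] ] ∑[ j < N S²[ n ] ] h i j
        ≡⟨ sum-cong-≗ (λ i → sum-cong-≗ (λ j → cong₂ (λ a b → a * b * f (decode {m} i) (decode {m} j)) (deg-decode m i) (deg-decode m j))) ⟩
      ∑[ i < N S²[ n ] ] ∑[ j < N S²[ n ] ] weight (decode {m} i) (decode {m} j)
        ≡⟨ sum-cong-≗ (λ i → sum-decode (weight (decode {m} i))) ⟩
      ∑[ i < N S²[ n ] ] ∑ᵛ (weight (decode {m} i))
        ≡⟨ sum-decode (λ p → ∑ᵛ (weight p)) ⟩
      ∑ᵛ (λ p → ∑ᵛ (weight p))
        ≡⟨ ∑ᵛ-weight ⟩
      2 * orbitTotal k α β γ δ ε ζ ∎)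
      where
      open ≡-Reasoning
      f : Vertex m → Vertex m → ℕ
      f = orbitwise α β γ δ ε ζ
      h : Fin (N S²[ n ]) → Fin (N S²[ n ]) → ℕ
      h i j = deg S²[ n ] i * deg S²[ n ] j * f (decode {m} i) (decode {m} j)
      h-symmetric : ∀ i j → h i j ≡ h j i
      h-symmetric i j = cong₂ _*_ (ℕ.*-comm (deg S²[ n ] i) (deg S²[ n ] j))
                                 (orbitwise-symmetric α β γ δ ε ζ (decode {m} i) (decode {m} j))
      h-diagonal : ∀ i → h i i ≡ 0
      h-diagonal i = trans (cong (deg S²[ n ] i * deg S²[ n ] i *_) (orbitwise-diagonal α β γ δ ε ζ (decode {m} i)))
                           (ℕ.*-zeroʳ (deg S²[ n ] i * deg S²[ n ] i))

module PrismPotentials where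

  open Prism
  open Orbits using (orbitwise; orbitTotal)
  open import Data.Bool using (if_then_else_)
  import Data.Fin as Fin
  open import Data.Fin.Patterns using (0F; 1F)
  open import Data.List using ([]; _∷_)
  open import Data.Nat using (ℕ; suc; _+_; _*_)
  open import Data.Nat.Tactic.RingSolver using (solve)
  open import Data.Product using (_,_)
  open import Function using (_∘_)
  open import Relation.Binary.PropositionalEquality
  open import Relation.Nullary using (yes; no)
  open ≡-Reasoning

  ground : ∀ {m} → Vertex m
  ground = centre , 0F

  denominator : ℕ → ℕ
  denominator m = 6 + 3 * suc m

  -- potential s p / denominator m is the potential at p of a unit current from s to ground,
  -- normalised to vanish at ground.
  potential : ∀ {m} → Vertex m → Vertex m → ℕ
  potential     (centre , 0F) _             = 0
  potential     (centre , 1F) (centre , 0F) = 0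
  potential     (centre , 1F) (centre , 1F) = 9
  potential     (centre , 1F) (leaf _ , 0F) = 3
  potential     (centre , 1F) (leaf _ , 1F) = 6
  potential     (leaf _ , 0F) (centre , 0F) = 0
  potential     (leaf _ , 0F) (centre , 1F) = 3
  potential {m} (leaf i , 0F) (leaf w , 0F) = if i == w then 2 * m + 7 else 1
  potential {m} (leaf i , 0F) (leaf w , 1F) = if i == w then m + 5 else 2
  potential     (leaf _ , 1F) (centre , 0F) = 0
  potential     (leaf _ , 1F) (centre , 1F) = 6
  potential {m} (leaf i , 1F) (leaf w , 0F) = if i == w then m + 5 else 2
  potential {m} (leaf i , 1F) (leaf w , 1F) = if i == w then 2 * m + 10 else 4

  -- Kirchhoff: degree p · P s p − Σ_{q ~ p} P s q = D · ([p = s] − [p = ground]), with no subtraction.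
  potential-harmonic : ∀ {m} (s p : Vertex m) →
    degree p * potential s p + (if p ==ᵛ ground then denominator m else 0) ≡
    neighbourSum (potential s) p + (if p ==ᵛ s then denominator m else 0)
  potential-harmonic {m} (centre , 0F) p =
    cong (_+ (if p ==ᵛ ground then denominator m else 0)) (sym (neighbourSum-const 0 p))
  potential-harmonic {m} (centre , 1F) (centre , 0F) rewrite ∑-const m 3 = solve (m ∷ [])
  potential-harmonic {m} (centre , 1F) (centre , 1F) rewrite ∑-const m 6 = solve (m ∷ [])
  potential-harmonic (centre , 1F) (leaf w , 0F) = refl
  potential-harmonic (centre , 1F) (leaf w , 1F) = refl
  potential-harmonic {suc k} (leaf i , 0F) (centre , 0F) rewrite ∑-count i (2 * suc k + 7) 1 = solve (k ∷ [])
  potential-harmonic {suc k} (leaf i , 0F) (centre , 1F) rewrite ∑-count i (suc k + 5) 2 = solve (k ∷ [])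
  potential-harmonic {m} (leaf i , 0F) (leaf w , 0F) with i Fin.≟ w
  ... | yes refl rewrite ==-refl i = begin 2 * (2 * m + 7) + 0 ≡⟨ solve (m ∷ []) ⟩ m + 5 + (6 + 3 * suc m) ∎
  ... | no i≢w rewrite ==-no (i≢w ∘ sym) = refl
  potential-harmonic {m} (leaf i , 0F) (leaf w , 1F) with i Fin.≟ w
  ... | yes refl rewrite ==-refl i = begin 2 * (m + 5) + 0 ≡⟨ solve (m ∷ []) ⟩ 3 + (2 * m + 7) + 0 ∎
  ... | no i≢w rewrite ==-no (i≢w ∘ sym) = refl
  potential-harmonic {suc k} (leaf i , 1F) (centre , 0F) rewrite ∑-count i (suc k + 5) 2 = solve (k ∷ [])
  potential-harmonic {suc k} (leaf i , 1F) (centre , 1F) rewrite ∑-count i (2 * suc k + 10) 4 = solve (k ∷ [])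
  potential-harmonic {m} (leaf i , 1F) (leaf w , 0F) with i Fin.≟ w
  ... | yes refl rewrite ==-refl i = begin 2 * (m + 5) + 0 ≡⟨ solve (m ∷ []) ⟩ 0 + (2 * m + 10) + 0 ∎
  ... | no i≢w rewrite ==-no (i≢w ∘ sym) = refl
  potential-harmonic {m} (leaf i , 1F) (leaf w , 1F) with i Fin.≟ w
  ... | yes refl rewrite ==-refl i = begin 2 * (2 * m + 10) + 0 ≡⟨ solve (m ∷ []) ⟩ 6 + (m + 5) + (6 + 3 * suc m) ∎
  ... | no i≢w rewrite ==-no (i≢w ∘ sym) = refl

  resistance : ∀ {m} → Vertex m → Vertex m → ℕ
  resistance {m} = orbitwise 9 (2 * m + 7) (2 * m + 10) (2 * m + 7) (4 * m + 12) (4 * m + 13)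

  kirchhoffNumerator : ℕ → ℕ
  kirchhoffNumerator k = orbitTotal k 9 (2 * m + 7) (2 * m + 10) (2 * m + 7) (4 * m + 12) (4 * m + 13)
    where
    m : ℕ
    m = suc k

  -- The effective resistance is P s s − P t s − P s t + P t t, with no subtraction.
  resistance-potential : ∀ {m} (s t : Vertex m) →
    potential s s + potential t t ≡ resistance s t + potential t s + potential s t
  resistance-potential (centre , 0F) (centre , 0F) = refl
  resistance-potential (centre , 0F) (centre , 1F) = refl
  resistance-potential (centre , 1F) (centre , 0F) = refl
  resistance-potential (centre , 1F) (centre , 1F) = refl
  resistance-potential {m} (centre , 0F) (leaf i , 0F) rewrite ==-refl i = begin 0 + (2 * m + 7) ≡⟨ solve (m ∷ []) ⟩ 2 * m + 7 + 0 + 0 ∎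
  resistance-potential {m} (centre , 0F) (leaf i , 1F) rewrite ==-refl i = begin 0 + (2 * m + 10) ≡⟨ solve (m ∷ []) ⟩ 2 * m + 10 + 0 + 0 ∎
  resistance-potential {m} (centre , 1F) (leaf i , 0F) rewrite ==-refl i = begin 9 + (2 * m + 7) ≡⟨ solve (m ∷ []) ⟩ 2 * m + 10 + 3 + 3 ∎
  resistance-potential {m} (centre , 1F) (leaf i , 1F) rewrite ==-refl i = begin 9 + (2 * m + 10) ≡⟨ solve (m ∷ []) ⟩ 2 * m + 7 + 6 + 6 ∎
  resistance-potential {m} (leaf i , 0F) (centre , 0F) rewrite ==-refl i = begin 2 * m + 7 + 0 ≡⟨ solve (m ∷ []) ⟩ 2 * m + 7 + 0 + 0 ∎
  resistance-potential {m} (leaf i , 0F) (centre , 1F) rewrite ==-refl i = begin 2 * m + 7 + 9 ≡⟨ solve (m ∷ []) ⟩ 2 * m + 10 + 3 + 3 ∎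
  resistance-potential {m} (leaf i , 1F) (centre , 0F) rewrite ==-refl i = begin 2 * m + 10 + 0 ≡⟨ solve (m ∷ []) ⟩ 2 * m + 10 + 0 + 0 ∎
  resistance-potential {m} (leaf i , 1F) (centre , 1F) rewrite ==-refl i = begin 2 * m + 10 + 9 ≡⟨ solve (m ∷ []) ⟩ 2 * m + 7 + 6 + 6 ∎
  resistance-potential {m} (leaf i , 0F) (leaf j , 0F) rewrite ==-refl i | ==-refl j with i Fin.≟ j
  ... | yes refl rewrite ==-refl i = begin (2 * m + 7) + (2 * m + 7) ≡⟨ solve (m ∷ []) ⟩ 0 + (2 * m + 7) + (2 * m + 7) ∎
  ... | no i≢j rewrite ==-no (i≢j ∘ sym) = begin (2 * m + 7) + (2 * m + 7) ≡⟨ solve (m ∷ []) ⟩ 4 * m + 12 + 1 + 1 ∎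
  resistance-potential {m} (leaf i , 0F) (leaf j , 1F) rewrite ==-refl i | ==-refl j with i Fin.≟ j
  ... | yes refl rewrite ==-refl i = begin (2 * m + 7) + (2 * m + 10) ≡⟨ solve (m ∷ []) ⟩ 2 * m + 7 + (m + 5) + (m + 5) ∎
  ... | no i≢j rewrite ==-no (i≢j ∘ sym) = begin (2 * m + 7) + (2 * m + 10) ≡⟨ solve (m ∷ []) ⟩ 4 * m + 13 + 2 + 2 ∎
  resistance-potential {m} (leaf i , 1F) (leaf j , 0F) rewrite ==-refl i | ==-refl j with i Fin.≟ j
  ... | yes refl rewrite ==-refl i = begin (2 * m + 10) + (2 * m + 7) ≡⟨ solve (m ∷ []) ⟩ 2 * m + 7 + (m + 5) + (m + 5) ∎
  ... | no i≢j rewrite ==-no (i≢j ∘ sym) = begin (2 * m + 10) + (2 * m + 7) ≡⟨ solve (m ∷ []) ⟩ 4 * m + 13 + 2 + 2 ∎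
  resistance-potential {m} (leaf i , 1F) (leaf j , 1F) rewrite ==-refl i | ==-refl j with i Fin.≟ j
  ... | yes refl rewrite ==-refl i = begin (2 * m + 10) + (2 * m + 10) ≡⟨ solve (m ∷ []) ⟩ 0 + (2 * m + 10) + (2 * m + 10) ∎
  ... | no i≢j rewrite ==-no (i≢j ∘ sym) = begin (2 * m + 10) + (2 * m + 10) ≡⟨ solve (m ∷ []) ⟩ 4 * m + 12 + 4 + 4 ∎

module PrismDistance where

  open GraphDistance using (dist≡)
  open Prism
  open Orbits using (orbitwise; orbitTotal)
  open import Data.Bool using (true; false; T; if_then_else_; _∧_)
  import Data.Bool.Properties as Bool
  open import Data.Fin as Fin using (Fin; combine)
  import Data.Fin.Properties as Fin
  open import Data.Fin.Patterns using (0F; 1F)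
  open import Data.Nat as ℕ using (ℕ; suc; _+_; _≤_; _<_; z≤n; s≤s)
  import Data.Nat.Properties as ℕ
  open import Data.Product using (∃; _×_; _,_; proj₁)
  open import Data.Sum using (_⊎_; inj₁; inj₂)
  open import Data.Unit using (tt)
  open import Function using (_∘_)
  open import Function.Bundles using (Equivalence)
  open import Relation.Binary.PropositionalEquality
  open import Relation.Nullary using (yes; no)

  starDistance : ∀ {m} → Fin (suc m) → Fin (suc m) → ℕ
  starDistance centre   centre   = 0
  starDistance centre   (leaf _) = 1
  starDistance (leaf _) centre   = 1
  starDistance (leaf i) (leaf w) = if i == w then 0 else 2

  layerDistance : Fin 2 → Fin 2 → ℕ
  layerDistance v v′ = if v == v′ then 0 else 1

  -- the graph distance in a Cartesian product is the sum of the distances in the factors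
  distance : ∀ {m} → Vertex m → Vertex m → ℕ
  distance (u , v) (u′ , v′) = starDistance u u′ + layerDistance v v′

  distance-orbitwise : ∀ {m} (p q : Vertex m) → distance p q ≡ orbitwise 1 1 2 1 2 3 p q
  distance-orbitwise (centre , 0F) (centre , 0F) = refl
  distance-orbitwise (centre , 0F) (centre , 1F) = refl
  distance-orbitwise (centre , 1F) (centre , 0F) = refl
  distance-orbitwise (centre , 1F) (centre , 1F) = refl
  distance-orbitwise (centre , 0F) (leaf _ , 0F) = refl
  distance-orbitwise (centre , 0F) (leaf _ , 1F) = refl
  distance-orbitwise (centre , 1F) (leaf _ , 0F) = refl
  distance-orbitwise (centre , 1F) (leaf _ , 1F) = refl
  distance-orbitwise (leaf _ , 0F) (centre , 0F) = refl
  distance-orbitwise (leaf _ , 0F) (centre , 1F) = refl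
  distance-orbitwise (leaf _ , 1F) (centre , 0F) = refl
  distance-orbitwise (leaf _ , 1F) (centre , 1F) = refl
  distance-orbitwise (leaf i , 0F) (leaf w , 0F) with i == w
  ... | true  = refl
  ... | false = refl
  distance-orbitwise (leaf i , 0F) (leaf w , 1F) with i == w
  ... | true  = refl
  ... | false = refl
  distance-orbitwise (leaf i , 1F) (leaf w , 0F) with i == w
  ... | true  = refl
  ... | false = refl
  distance-orbitwise (leaf i , 1F) (leaf w , 1F) with i == w
  ... | true  = refl
  ... | false = refl

  gutmanIndex : ℕ → ℕ
  gutmanIndex k = orbitTotal k 1 1 2 1 2 3

  starDistance-refl : ∀ {m} (u : Fin (suc m)) → starDistance u u ≡ 0
  starDistance-refl centre   = refl
  starDistance-refl (leaf i) rewrite ==-refl i = refl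

  distance-refl : ∀ {m} (p : Vertex m) → distance p p ≡ 0
  distance-refl (u , v) rewrite starDistance-refl u | ==-refl v = refl

  starDistance-zero : ∀ {m} {u u′ : Fin (suc m)} → starDistance u u′ ≡ 0 → u ≡ u′
  starDistance-zero {u = centre}   {centre}   _ = refl
  starDistance-zero {u = leaf i}   {leaf w}   d≡0 with i Fin.≟ w
  ... | yes refl = refl
  starDistance-zero {u = leaf i}   {leaf w}   () | no _

  layerDistance-zero : ∀ {v v′} → layerDistance v v′ ≡ 0 → v ≡ v′
  layerDistance-zero {v} {v′} d≡0 with v Fin.≟ v′
  ... | yes v≡v′ = v≡v′
  layerDistance-zero {v} {v′} () | no _

  distance-zero : ∀ {m} {p q : Vertex m} → distance p q ≡ 0 → p ≡ q
  distance-zero {p = u , v} d≡0 = cong₂ _,_ (starDistance-zero (ℕ.m+n≡0⇒m≡0 _ d≡0)) (layerDistance-zero (ℕ.m+n≡0⇒n≡0 _ d≡0))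

  layerDistance-≤1 : ∀ v v′ → layerDistance v v′ ≤ 1
  layerDistance-≤1 v v′ with v == v′
  ... | true  = z≤n
  ... | false = s≤s z≤n

  starDistance-≤2 : ∀ {m} (u u′ : Fin (suc m)) → starDistance u u′ ≤ 2
  starDistance-≤2 centre   centre   = z≤n
  starDistance-≤2 centre   (leaf _) = s≤s z≤n
  starDistance-≤2 (leaf _) centre   = s≤s z≤n
  starDistance-≤2 (leaf i) (leaf w) with i == w
  ... | true  = z≤n
  ... | false = s≤s (s≤s z≤n)

  distance-≤3 : ∀ {m} (p q : Vertex m) → distance p q ≤ 3
  distance-≤3 (u , v) (u′ , v′) = ℕ.+-mono-≤ (starDistance-≤2 u u′) (layerDistance-≤1 v v′)

  adjacent-cases : ∀ {m} {u₁ u₂ : Fin (suc m)} {v₁ v₂} → T (adjacent (u₁ , v₁) (u₂ , v₂)) →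
                   u₁ ≡ u₂ ⊎ (v₁ ≡ v₂ × T (adj (Star (suc m)) u₁ u₂))
  adjacent-cases a with Equivalence.to Bool.T-∨ a
  ... | inj₁ rung  = inj₁ (==⇒≡ (proj₁ (Equivalence.to Bool.T-∧ rung)))
  ... | inj₂ spoke = let v₁≡v₂ , star = Equivalence.to Bool.T-∧ spoke in inj₂ (==⇒≡ v₁≡v₂ , star)

  starDistance-edge : ∀ {m} (a : Fin (suc m)) {u₁ u₂} → T (adj (Star (suc m)) u₁ u₂) →
                      starDistance a u₂ ≤ suc (starDistance a u₁)
  starDistance-edge centre   {centre}   {leaf _}   _ = s≤s z≤n
  starDistance-edge centre   {leaf _}   {centre}   _ = z≤n
  starDistance-edge (leaf i) {centre}   {leaf w}   _ = starDistance-≤2 (leaf i) (leaf w)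
  starDistance-edge (leaf i) {leaf _}   {centre}   _ = s≤s z≤n

  distance-edge : ∀ {m} (p : Vertex m) {r q} → T (adjacent r q) → distance p q ≤ suc (distance p r)
  distance-edge (a , b) {u₁ , v₁} {u₂ , v₂} r~q with adjacent-cases {u₁ = u₁} {u₂} {v₁} {v₂} r~q
  ... | inj₁ refl = begin
    starDistance a u₁ + layerDistance b v₂        ≤⟨ ℕ.+-monoʳ-≤ (starDistance a u₁) (ℕ.≤-trans (layerDistance-≤1 b v₂) (s≤s z≤n)) ⟩
    starDistance a u₁ + suc (layerDistance b v₁)  ≡⟨ ℕ.+-suc (starDistance a u₁) (layerDistance b v₁) ⟩
    suc (starDistance a u₁ + layerDistance b v₁) ∎
    where open ℕ.≤-Reasoning
  ... | inj₂ (refl , star) = ℕ.+-monoˡ-≤ (layerDistance b v₁) (starDistance-edge a star)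

  starDistance-step : ∀ {m} (a u : Fin (suc m)) → 0 < starDistance a u →
                      ∃ λ u′ → T (adj (Star (suc m)) u′ u) × suc (starDistance a u′) ≡ starDistance a u
  starDistance-step centre   (leaf w) _ = centre , tt , refl
  starDistance-step (leaf i) centre   _ = leaf i , tt , cong suc (starDistance-refl (leaf i))
  starDistance-step (leaf i) (leaf w) 0<d with i Fin.≟ w
  ... | no _ = centre , tt , refl
  starDistance-step (leaf i) (leaf .i) () | yes refl

  layerDistance-refl : ∀ v → layerDistance v v ≡ 0
  layerDistance-refl v rewrite ==-refl v = refl

  rung-adjacent : ∀ {m} (u : Fin (suc m)) {v v′} → v ≢ v′ → T (adjacent (u , v) (u , v′))
  rung-adjacent u v≢v′ rewrite ==-refl u | ==-no v≢v′ = tt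

  spoke-adjacent : ∀ {m} {u u′ : Fin (suc m)} v → T (adj (Star (suc m)) u u′) → T (adjacent (u , v) (u′ , v))
  spoke-adjacent {u = u} {u′} v star rewrite ==-refl v = Equivalence.from (Bool.T-∨ {(u == u′) ∧ false}) (inj₂ star)

  distance-step : ∀ {m} (p q : Vertex m) → 0 < distance p q →
                  ∃ λ r → T (adjacent r q) × suc (distance p r) ≡ distance p q
  distance-step (a , b) (u , v) 0<d with b Fin.≟ v
  ... | no b≢v = (u , b) , rung-adjacent u b≢v , (begin
    suc (starDistance a u + layerDistance b b) ≡⟨ cong (λ x → suc (starDistance a u + x)) (layerDistance-refl b) ⟩
    suc (starDistance a u + 0)                 ≡⟨ cong suc (ℕ.+-identityʳ _) ⟩
    suc (starDistance a u)                     ≡⟨ ℕ.+-comm 1 (starDistance a u) ⟩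
    starDistance a u + 1 ∎)
    where open ≡-Reasoning
  ... | yes refl with starDistance-step a u (subst (0 <_) (ℕ.+-identityʳ (starDistance a u)) 0<d)
  ...   | u′ , star , step = (u′ , b) , spoke-adjacent {u = u′} {u} b star , (begin
    suc (starDistance a u′ + layerDistance b b) ≡⟨ cong (λ x → suc (starDistance a u′ + x)) (layerDistance-refl b) ⟩
    suc (starDistance a u′ + 0)                 ≡⟨ cong suc (ℕ.+-identityʳ _) ⟩
    suc (starDistance a u′)                     ≡⟨ step ⟩
    starDistance a u                            ≡˘⟨ ℕ.+-identityʳ _ ⟩
    starDistance a u + 0 ∎)
    where open ≡-Reasoning

  dist-decode : ∀ k (x y : Fin (N S²[ suc (suc k) ])) → dist S²[ suc (suc k) ] x y ≡ distance (decode {suc k} x) (decode y)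
  dist-decode k x y = dist≡ G d (distance-refl ∘ decode) (decode-injective ∘ distance-zero)
                       (λ x → distance-edge (decode {m} x)) step x y (bound x y)
    where
    m : ℕ
    m = suc k
    G : Graph
    G = S²[ suc m ]
    d : Fin (N G) → Fin (N G) → ℕ
    d x y = distance (decode {m} x) (decode y)
    step : ∀ x y → 0 < d x y → ∃ λ z → T (adj G z y) × suc (d x z) ≡ d x y
    step x y 0<d with distance-step (decode {m} x) (decode {m} y) 0<d
    ... | (u , v) , r~y , r-closer = combine u v ,
          subst (λ r → T (adjacent r (decode {m} y)) × suc (distance (decode {m} x) r) ≡ d x y)
                (sym (Fin.remQuot-combine u v)) (r~y , r-closer)
    bound : ∀ x y → d x y < N G
    bound x y = ℕ.≤-trans (s≤s (distance-≤3 (decode {m} x) (decode {m} y))) (s≤s (s≤s (s≤s (s≤s z≤n))))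

module RationalArithmetic where

  open RationalRingSolver
  open RationalSums using (sum)
  open import Data.Bool using (true; false; if_then_else_)
  open import Data.Empty using (⊥-elim)
  open import Data.Fin using (Fin; zero; suc)
  open import Data.Integer as ℤ using (+_; +[1+_])
  import Data.Integer.Properties as ℤ
  import Data.Integer.Tactic.RingSolver as ℤ-Solver
  open import Data.Nat as ℕ using (ℕ; zero; suc)
  open import Data.Nat.Coprimality using (Coprime)
  import Data.Nat.Properties as ℕ
  open import Data.Rational as ℚ using (ℚ; mkℚ; 0ℚ; 1ℚ; _+_; _-_; _*_; _/_; _<_; 1/_)
  import Data.Rational.Properties as ℚ
  open import Data.Rational.Unnormalised as ℚᵘ using (mkℚᵘ; *≡*) renaming (_≃_ to _≃ᵘ_)
  import Data.Rational.Unnormalised.Properties as ℚᵘ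
  open import Function using (_∘_)
  open import Relation.Binary.PropositionalEquality
  open import Relation.Nullary using (yes; no)

  toℚᵘ-ℕ→ℚ : ∀ k → ℚ.toℚᵘ (ℕ→ℚ k) ≃ᵘ mkℚᵘ (+ k) 0
  toℚᵘ-ℕ→ℚ k = ℚ.toℚᵘ-fromℚᵘ (mkℚᵘ (+ k) 0)

  toℚᵘ-/ : ∀ a d → ℚ.toℚᵘ ((+ a) / suc d) ≃ᵘ mkℚᵘ (+ a) d
  toℚᵘ-/ a d = ℚ.toℚᵘ-fromℚᵘ (mkℚᵘ (+ a) d)

  ℕ→ℚ-+ : ∀ a b → ℕ→ℚ (a ℕ.+ b) ≡ ℕ→ℚ a + ℕ→ℚ b
  ℕ→ℚ-+ a b = ℚ.toℚᵘ-injective (begin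
    ℚ.toℚᵘ (ℕ→ℚ (a ℕ.+ b))                      ≈⟨ toℚᵘ-ℕ→ℚ (a ℕ.+ b) ⟩
    mkℚᵘ (+ (a ℕ.+ b)) 0                        ≈⟨ *≡* (cross (+ a) (+ b)) ⟩
    mkℚᵘ (+ a) 0 ℚᵘ.+ mkℚᵘ (+ b) 0             ≈⟨ ℚᵘ.+-cong (toℚᵘ-ℕ→ℚ a) (toℚᵘ-ℕ→ℚ b) ⟨
    ℚ.toℚᵘ (ℕ→ℚ a) ℚᵘ.+ ℚ.toℚᵘ (ℕ→ℚ b)         ≈⟨ ℚ.toℚᵘ-homo-+ (ℕ→ℚ a) (ℕ→ℚ b) ⟨
    ℚ.toℚᵘ (ℕ→ℚ a + ℕ→ℚ b) ∎)
    where
    open import Relation.Binary.Reasoning.Setoid ℚᵘ.≃-setoid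
    cross : ∀ x y → (x ℤ.+ y) ℤ.* (+ 1 ℤ.* + 1) ≡ (x ℤ.* + 1 ℤ.+ y ℤ.* + 1) ℤ.* + 1
    cross = ℤ-Solver.solve-∀

  ℕ→ℚ-* : ∀ a b → ℕ→ℚ (a ℕ.* b) ≡ ℕ→ℚ a * ℕ→ℚ b
  ℕ→ℚ-* a b = ℚ.toℚᵘ-injective (begin
    ℚ.toℚᵘ (ℕ→ℚ (a ℕ.* b))                      ≈⟨ toℚᵘ-ℕ→ℚ (a ℕ.* b) ⟩
    mkℚᵘ (+ (a ℕ.* b)) 0                        ≈⟨ *≡* (cong (λ x → x ℤ.* + 1) (ℤ.pos-* a b)) ⟩
    mkℚᵘ (+ a) 0 ℚᵘ.* mkℚᵘ (+ b) 0             ≈⟨ ℚᵘ.*-cong (toℚᵘ-ℕ→ℚ a) (toℚᵘ-ℕ→ℚ b) ⟨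
    ℚ.toℚᵘ (ℕ→ℚ a) ℚᵘ.* ℚ.toℚᵘ (ℕ→ℚ b)         ≈⟨ ℚ.toℚᵘ-homo-* (ℕ→ℚ a) (ℕ→ℚ b) ⟨
    ℚ.toℚᵘ (ℕ→ℚ a * ℕ→ℚ b) ∎)
    where open import Relation.Binary.Reasoning.Setoid ℚᵘ.≃-setoid

  /-ℕ→ℚ : ∀ a d → (+ a) / suc d ≡ ℕ→ℚ a * ((+ 1) / suc d)
  /-ℕ→ℚ a d = ℚ.toℚᵘ-injective (begin
    ℚ.toℚᵘ ((+ a) / suc d)                               ≈⟨ toℚᵘ-/ a d ⟩
    mkℚᵘ (+ a) d                                         ≈⟨ *≡* cross ⟩
    mkℚᵘ (+ a) 0 ℚᵘ.* mkℚᵘ (+ 1) d                      ≈⟨ ℚᵘ.*-cong (toℚᵘ-ℕ→ℚ a) (toℚᵘ-/ 1 d) ⟨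
    ℚ.toℚᵘ (ℕ→ℚ a) ℚᵘ.* ℚ.toℚᵘ ((+ 1) / suc d)          ≈⟨ ℚ.toℚᵘ-homo-* (ℕ→ℚ a) ((+ 1) / suc d) ⟨
    ℚ.toℚᵘ (ℕ→ℚ a * ((+ 1) / suc d)) ∎)
    where
    open import Relation.Binary.Reasoning.Setoid ℚᵘ.≃-setoid
    cross : + a ℤ.* + suc (d ℕ.+ 0) ≡ (+ a ℤ.* + 1) ℤ.* + suc d
    cross rewrite ℕ.+-identityʳ d = cong (ℤ._* + suc d) (sym (ℤ.*-identityʳ (+ a)))

  ℕ→ℚ-inverse : ∀ d → ℕ→ℚ (suc d) * ((+ 1) / suc d) ≡ 1ℚ
  ℕ→ℚ-inverse d = trans (sym (/-ℕ→ℚ (suc d) d)) (ℚ.toℚᵘ-injective (ℚᵘ.≃-trans (toℚᵘ-/ (suc d) d) (*≡* (cross (+ d)))))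
    where
    cross : ∀ x → (+ 1 ℤ.+ x) ℤ.* + 1 ≡ + 1 ℤ.* (+ 1 ℤ.+ x)
    cross = ℤ-Solver.solve-∀

  ÷'-by-inverse : ∀ p q w → q * w ≡ 1ℚ → p ÷' q ≡ p * w
  ÷'-by-inverse p q w q*w≡1 with q ℚ.≟ 0ℚ
  ... | yes refl = ⊥-elim (0≢1 (trans (sym (ℚ.*-zeroˡ w)) q*w≡1))
    where
    0≢1 : 0ℚ ≢ 1ℚ
    0≢1 ()
  ... | no q≢0 = cong (p *_) (begin
    1/ q                  ≡˘⟨ ℚ.*-identityʳ (1/ q) ⟩
    1/ q * 1ℚ             ≡˘⟨ cong (1/ q *_) q*w≡1 ⟩
    1/ q * (q * w)        ≡˘⟨ ℚ.*-assoc (1/ q) q w ⟩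
    1/ q * q * w          ≡⟨ cong (_* w) (ℚ.*-inverseˡ q) ⟩
    1ℚ * w                ≡⟨ ℚ.*-identityˡ w ⟩
    w ∎)
    where
    open ≡-Reasoning
    instance
      q-nonZero : ℚ.NonZero q
      q-nonZero = ℚ.≢-nonZero q≢0

  fraction-unique : ∀ {x} a e → x * ℕ→ℚ (suc e) ≡ ℕ→ℚ a → x ≡ (+ a) / suc e
  fraction-unique {x} a e x*e≡a = begin
    x                                    ≡˘⟨ ℚ.*-identityʳ x ⟩
    x * 1ℚ                               ≡˘⟨ cong (x *_) (ℕ→ℚ-inverse e) ⟩
    x * (ℕ→ℚ (suc e) * ((+ 1) / suc e))  ≡˘⟨ ℚ.*-assoc x (ℕ→ℚ (suc e)) ((+ 1) / suc e) ⟩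
    x * ℕ→ℚ (suc e) * ((+ 1) / suc e)    ≡⟨ cong (_* ((+ 1) / suc e)) x*e≡a ⟩
    ℕ→ℚ a * ((+ 1) / suc e)              ≡˘⟨ /-ℕ→ℚ a e ⟩
    (+ a) / suc e ∎
    where open ≡-Reasoning

  /-<-mkℚ : ∀ a e p q .(c : Coprime (suc p) (suc q)) → a ℕ.* suc q ℕ.< suc p ℕ.* suc e →
            (+ a) / suc e < mkℚ +[1+ p ] q c
  /-<-mkℚ a e p q c a*q<p*e =
    ℚ.toℚᵘ-cancel-< (ℚᵘ.<-respˡ-≃ (ℚᵘ.≃-sym (toℚᵘ-/ a e)) (ℚᵘ.*<* (subst₂ ℤ._<_ (ℤ.pos-* a (suc q)) (ℤ.pos-* (suc p) (suc e)) (ℤ.+<+ a*q<p*e))))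

  pos-balance : ∀ a c e t → a ℕ.+ e ≡ t ℕ.+ c → + a ℤ.- + c ℤ.+ + e ≡ + t
  pos-balance a c e t a+e≡t+c = begin
    + a ℤ.- + c ℤ.+ + e     ≡⟨ swap (+ a) (+ c) (+ e) ⟩
    + (a ℕ.+ e) ℤ.- + c     ≡⟨ cong (λ x → + x ℤ.- + c) a+e≡t+c ⟩
    + t ℤ.+ + c ℤ.- + c     ≡⟨ cancel (+ t) (+ c) ⟩
    + t ∎
    where
    open ≡-Reasoning
    swap : ∀ x y z → x ℤ.- y ℤ.+ z ≡ x ℤ.+ z ℤ.- y
    swap = ℤ-Solver.solve-∀
    cancel : ∀ x y → x ℤ.+ y ℤ.- y ≡ x
    cancel = ℤ-Solver.solve-∀

  module Scaling (d : ℕ) where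

    -- Opaque because unfolding the normalising division on a symbolic denominator makes
    -- conversion checking blow up.
    opaque
      scale : ℕ → ℚ
      scale k = ℕ→ℚ k * ((+ 1) / suc d)

    opaque
      unfolding scale

      scale-+ : ∀ a b → scale (a ℕ.+ b) ≡ scale a + scale b
      scale-+ a b = trans (cong (_* ((+ 1) / suc d)) (ℕ→ℚ-+ a b)) (ℚ.*-distribʳ-+ ((+ 1) / suc d) (ℕ→ℚ a) (ℕ→ℚ b))

      scale-zero : scale 0 ≡ 0ℚ
      scale-zero = ℚ.*-zeroˡ ((+ 1) / suc d)

      scale-one : scale (suc d) ≡ 1ℚ
      scale-one = ℕ→ℚ-inverse d

      ℕ→ℚ-*-scale : ∀ a b → ℕ→ℚ a * scale b ≡ scale (a ℕ.* b)
      ℕ→ℚ-*-scale a b = trans (sym (ℚ.*-assoc (ℕ→ℚ a) (ℕ→ℚ b) _)) (cong (_* ((+ 1) / suc d)) (sym (ℕ→ℚ-* a b)))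

      scale-*-denominator : ∀ a → scale a * ℕ→ℚ (suc d) ≡ ℕ→ℚ a
      scale-*-denominator a = begin
        ℕ→ℚ a * u * ℕ→ℚ (suc d)   ≡⟨ ℚ.*-assoc (ℕ→ℚ a) u (ℕ→ℚ (suc d)) ⟩
        ℕ→ℚ a * (u * ℕ→ℚ (suc d)) ≡⟨ cong (ℕ→ℚ a *_) (trans (ℚ.*-comm u (ℕ→ℚ (suc d))) (ℕ→ℚ-inverse d)) ⟩
        ℕ→ℚ a * 1ℚ                ≡⟨ ℚ.*-identityʳ (ℕ→ℚ a) ⟩
        ℕ→ℚ a ∎
        where
        open ≡-Reasoning
        u : ℚ
        u = (+ 1) / suc d

      /-scale : ∀ a → (+ a) / suc d ≡ scale a
      /-scale a = /-ℕ→ℚ a d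

    scale-if : ∀ b k → (if b then scale k else 0ℚ) ≡ scale (if b then k else 0)
    scale-if true  k = refl
    scale-if false k = sym scale-zero

    scale-if-* : ∀ b a c → (if b then ℕ→ℚ a * scale c else 0ℚ) ≡ scale (if b then a ℕ.* c else 0)
    scale-if-* true  a c = ℕ→ℚ-*-scale a c
    scale-if-* false a c = sym scale-zero

    scale-sum : ∀ {n} (f : Fin n → ℕ) → sum (scale ∘ f) ≡ scale (NaturalSums.sum f)
    scale-sum {zero}  f = sym scale-zero
    scale-sum {suc n} f = trans (cong (λ x → scale (f zero) + x) (scale-sum (f ∘ suc))) (sym (scale-+ (f zero) _))

    scale-balance : ∀ {a b c e} → a ℕ.+ e ≡ b ℕ.+ c → scale a - scale b ≡ scale c - scale e
    scale-balance {a} {b} {c} {e} a+e≡b+c = begin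
      scale a - scale b                         ≡⟨ shift (scale a) (scale b) (scale e) ⟩
      (scale a + scale e) - scale e - scale b   ≡⟨ cong (λ x → x - scale e - scale b) (trans (sym (scale-+ a e)) (trans (cong scale a+e≡b+c) (scale-+ b c))) ⟩
      (scale b + scale c) - scale e - scale b   ≡⟨ unshift (scale b) (scale c) (scale e) ⟩
      scale c - scale e ∎
      where
      open ≡-Reasoning
      shift : ∀ x y z → x - y ≡ (x + z) - z - y
      shift = solve-∀ ℚ-ring
      unshift : ∀ x y z → (x + y) - z - x ≡ y - z
      unshift = solve-∀ ℚ-ring

    scale-resistance : ∀ {a b c e r} → a ℕ.+ e ≡ r ℕ.+ b ℕ.+ c → (scale a - scale b) - (scale c - scale e) ≡ scale r
    scale-resistance {a} {b} {c} {e} {r} a+e≡r+b+c = begin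
      (scale a - scale b) - (scale c - scale e)      ≡⟨ regroup (scale a) (scale b) (scale c) (scale e) ⟩
      (scale a + scale e) - scale b - scale c        ≡⟨ cong (λ x → x - scale b - scale c) split ⟩
      (scale r + scale b + scale c) - scale b - scale c ≡⟨ cancel (scale r) (scale b) (scale c) ⟩
      scale r ∎
      where
      open ≡-Reasoning
      regroup : ∀ x y z w → (x - y) - (z - w) ≡ (x + w) - y - z
      regroup = solve-∀ ℚ-ring
      cancel : ∀ x y z → (x + y + z) - y - z ≡ x
      cancel = solve-∀ ℚ-ring
      split : scale a + scale e ≡ scale r + scale b + scale c
      split = trans (sym (scale-+ a e)) (trans (cong scale a+e≡r+b+c) (trans (scale-+ (r ℕ.+ b) c) (cong (_+ scale c) (scale-+ r b))))

module PrismIndices where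

  open EffectiveResistance
  open NaturalSums using (sumℕ≡sum)
  open Orbits
  open Prism
  open PrismDistance
  open PrismPotentials
  open RationalArithmetic
  open RationalSums
  open import Data.Bool using (true; false; if_then_else_)
  open import Data.Fin as Fin using (Fin; toℕ)
  open import Data.Nat as ℕ using (ℕ; suc; _<ᵇ_)
  import Data.Nat.Properties as ℕ
  open import Data.Rational using (ℚ; 0ℚ; 1ℚ; _*_; _-_)
  open import Function using (_∘_)
  open import Relation.Binary.PropositionalEquality

  module ℕΣ = NaturalSums

  module PrismResistance (m : ℕ) where

    open Scaling (5 ℕ.+ 3 ℕ.* suc m) public

    private
      G : Graph
      G = S²[ suc m ]
      V : Set
      V = Fin (N G)

    groundedPotential : V → V → ℚ
    groundedPotential s x = scale (potential (decode {m} s) (decode x))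

    private
      scale-neighbours : ∀ (g : Vertex m → ℕ) x →
        sum (λ j → if adj G x j then scale (g (decode j)) else 0ℚ) ≡ scale (neighbourSum g (decode x))
      scale-neighbours g x =
        trans (sum-cong-≗ λ j → scale-if (adj G x j) (g (decode j)))
              (trans (scale-sum (λ j → if adj G x j then g (decode j) else 0)) (cong scale (sum-neighbours g x)))

      scale-indicator : ∀ b → scale (if b then denominator m else 0) ≡ (if b then 1ℚ else 0ℚ)
      scale-indicator true  = scale-one
      scale-indicator false = scale-zero

      δ-decode : ∀ x y → δ x y ≡ (if decode {m} x ==ᵛ decode y then 1ℚ else 0ℚ)
      δ-decode x y = cong (λ b → if b then 1ℚ else 0ℚ) (==-decode {m} x y)

    laplacian-groundedPotential : ∀ s x → laplacian G (groundedPotential s) x ≡ δ x s - δ x Fin.zero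
    laplacian-groundedPotential s x = begin
      laplacian G ψ x                                           ≡⟨ sumℚ≡sum (λ j → if adj G x j then ψ x - ψ j else 0ℚ) ⟩
      sum (λ j → if adj G x j then ψ x - ψ j else 0ℚ)           ≡⟨ sum-cong-≗ (λ j → if-sub (adj G x j) (ψ x) (ψ j)) ⟩
      ∑[ j < N G ] (around (λ _ → ψ x) j - around ψ j)          ≡⟨ ∑-distrib-sub (around (λ _ → ψ x)) (around ψ) ⟩
      sum (around (λ _ → ψ x)) - sum (around ψ)                 ≡⟨ cong₂ _-_ (scale-neighbours (λ _ → potential ps px) x)
                                                                              (scale-neighbours (potential ps) x) ⟩
      scale (neighbourSum (λ _ → potential ps px) px) - scale (neighbourSum (potential ps) px)
        ≡⟨ cong (λ a → scale a - scale (neighbourSum (potential ps) px)) (neighbourSum-const (potential ps px) px) ⟩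
      scale (degree px ℕ.* potential ps px) - scale (neighbourSum (potential ps) px)
        ≡⟨ scale-balance (potential-harmonic ps px) ⟩
      scale (if px ==ᵛ ps then denominator m else 0) - scale (if px ==ᵛ ground then denominator m else 0)
        ≡⟨ cong₂ _-_ (scale-indicator (px ==ᵛ ps)) (scale-indicator (px ==ᵛ ground)) ⟩
      (if px ==ᵛ ps then 1ℚ else 0ℚ) - (if px ==ᵛ ground then 1ℚ else 0ℚ)
        ≡˘⟨ cong₂ _-_ (δ-decode x s) (δ-decode x Fin.zero) ⟩
      δ x s - δ x Fin.zero ∎
      where
      open ≡-Reasoning
      ψ : V → ℚ
      ψ = groundedPotential s
      ps px : Vertex m
      ps = decode s
      px = decode x
      around : (V → ℚ) → V → ℚ
      around f j = if adj G x j then f j else 0ℚ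

    effectiveResistance : ResFn G
    effectiveResistance s t = scale (resistance (decode {m} s) (decode t))

    effectiveResistance-isResistanceFn : IsResistanceFn G effectiveResistance
    effectiveResistance-isResistanceFn s t =
      subst (IsResistance G s t)
            (scale-resistance (resistance-potential ps pt))
            (resistance-from-grounded G Fin.zero groundedPotential laplacian-groundedPotential s t)
      where
      ps pt : Vertex m
      ps = decode s
      pt = decode t

    resistanceFn≡effectiveResistance : ∀ r → IsResistanceFn G r → ∀ s t → r s t ≡ effectiveResistance s t
    resistanceFn≡effectiveResistance r r-res s t =
      resistance-unique G (prism-symmetric m) (r-res s t) (effectiveResistance-isResistanceFn s t)

  module _ (k : ℕ) where

    private
      m : ℕ
      m = suc k
      G : Graph
      G = S²[ suc m ]
      open PrismResistance m

    KfStar-prism : ∀ r → IsResistanceFn G r → KfStar G r ≡ scale (kirchhoffNumerator k)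
    KfStar-prism r r-res = begin
      KfStar G r
        ≡⟨ sumℚ≡sum (λ i → sumℚ (term i)) ⟩
      sum (λ i → sumℚ (term i))
        ≡⟨ sum-cong-≗ (λ i → sumℚ≡sum (term i)) ⟩
      ∑[ i < N G ] ∑[ j < N G ] term i j
        ≡⟨ sum-cong-≗ (λ i → sum-cong-≗ (term-scaled i)) ⟩
      ∑[ i < N G ] ∑[ j < N G ] scale (h i j)
        ≡⟨ sum-cong-≗ (λ i → scale-sum (h i)) ⟩
      ∑[ i < N G ] scale (ℕΣ.sum (h i))
        ≡⟨ scale-sum (ℕΣ.sum ∘ h) ⟩
      scale (ℕΣ.∑[ i < N G ] ℕΣ.sum (h i))
        ≡⟨ cong scale (upper-orbit-sum k 9 (2 ℕ.* m ℕ.+ 7) (2 ℕ.* m ℕ.+ 10) (2 ℕ.* m ℕ.+ 7) (4 ℕ.* m ℕ.+ 12) (4 ℕ.* m ℕ.+ 13)) ⟩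
      scale (kirchhoffNumerator k) ∎
      where
      open ≡-Reasoning
      term : Fin (N G) → Fin (N G) → ℚ
      term i j = if toℕ i <ᵇ toℕ j then ℕ→ℚ (deg G i ℕ.* deg G j) * r i j else 0ℚ
      h : Fin (N G) → Fin (N G) → ℕ
      h i j = if toℕ i <ᵇ toℕ j then deg G i ℕ.* deg G j ℕ.* resistance (decode {m} i) (decode j) else 0
      term-scaled : ∀ i j → term i j ≡ scale (h i j)
      term-scaled i j = trans (cong (λ x → if toℕ i <ᵇ toℕ j then ℕ→ℚ (deg G i ℕ.* deg G j) * x else 0ℚ)
                                    (resistanceFn≡effectiveResistance r r-res i j))
                              (scale-if-* (toℕ i <ᵇ toℕ j) (deg G i ℕ.* deg G j) (resistance (decode {m} i) (decode j)))

    Gut-prism : Gut G ≡ gutmanIndex k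
    Gut-prism = begin
      Gut G                                ≡⟨ sumℕ≡sum (λ i → sumℕ (term i)) ⟩
      ℕΣ.sum (λ i → sumℕ (term i))         ≡⟨ ℕΣ.sum-cong-≗ (λ i → sumℕ≡sum (term i)) ⟩
      ℕΣ.∑[ i < N G ] ℕΣ.sum (term i)      ≡⟨ ℕΣ.sum-cong-≗ (λ i → ℕΣ.sum-cong-≗ (term-orbitwise i)) ⟩
      ℕΣ.∑[ i < N G ] ℕΣ.sum (h i)         ≡⟨ upper-orbit-sum k 1 1 2 1 2 3 ⟩
      gutmanIndex k ∎
      where
      open ≡-Reasoning
      term h : Fin (N G) → Fin (N G) → ℕ
      term i j = if toℕ i <ᵇ toℕ j then deg G i ℕ.* deg G j ℕ.* dist G i j else 0
      h    i j = if toℕ i <ᵇ toℕ j then deg G i ℕ.* deg G j ℕ.* orbitwise 1 1 2 1 2 3 (decode {m} i) (decode j) else 0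
      term-orbitwise : ∀ i j → term i j ≡ h i j
      term-orbitwise i j = cong (λ d → if toℕ i <ᵇ toℕ j then deg G i ℕ.* deg G j ℕ.* d else 0)
                                (trans (dist-decode k i j) (distance-orbitwise (decode {m} i) (decode j)))

module IndexPolynomials where

  open PrismDistance using (gutmanIndex)
  open PrismPotentials using (denominator; kirchhoffNumerator)
  open import Data.Nat using (ℕ; suc; _+_; _*_; _<_)
  import Data.Nat.Properties as ℕ
  open import Data.Nat.Tactic.RingSolver using (solve-∀)
  open import Relation.Binary.PropositionalEquality

  module _ (k : ℕ) where

    private
      m n : ℕ
      m = suc k
      n = suc m

    deviationNumerator deviationDenominator : ℕ
    deviationNumerator   = 921 * k * k + 2544 * k + 1776
    deviationDenominator = 33 * denominator m * gutmanIndex k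

    kirchhoffNumerator-cubic : 48 * n * n * n + 25 * n * n + 116 ≡ kirchhoffNumerator k + 180 * n
    kirchhoffNumerator-cubic = cubic k
      where
      cubic : ∀ k → let m = suc k; n = suc m in
        48 * n * n * n + 25 * n * n + 116 ≡
        (n * n * 9 + 4 * n * m * ((2 * m + 7) + (2 * m + 10)) + 4 * m * (2 * m + 7)
          + 4 * m * k * ((4 * m + 12) + (4 * m + 13))) + 180 * n
      cubic = solve-∀

    kirchhoffNumerator-split : 33 * kirchhoffNumerator k ≡ 16 * denominator m * gutmanIndex k + deviationNumerator
    kirchhoffNumerator-split = split k
      where
      split : ∀ k → let m = suc k; n = suc m in
        33 * (n * n * 9 + 4 * n * m * ((2 * m + 7) + (2 * m + 10)) + 4 * m * (2 * m + 7)
              + 4 * m * k * ((4 * m + 12) + (4 * m + 13)))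
        ≡ 16 * (6 + 3 * n) * (n * n * 1 + 4 * n * m * (1 + 2) + 4 * m * 1 + 4 * m * k * (2 + 3))
          + (921 * k * k + 2544 * k + 1776)
      split = solve-∀

    deviation-bound : deviationNumerator * suc k < deviationDenominator
    deviation-bound = subst (deviationNumerator * suc k <_) (sym (expand k)) (ℕ.m≤m+n (suc (deviationNumerator * suc k)) _)
      where
      expand : ∀ k → let m = suc k; n = suc m in
        33 * (6 + 3 * n) * (n * n * 1 + 4 * n * m * (1 + 2) + 4 * m * 1 + 4 * m * k * (2 + 3))
        ≡ suc ((921 * k * k + 2544 * k + 1776) * suc k) + (2346 * k * k * k + 15939 * k * k + 24192 * k + 10895)
      expand = solve-∀

module KirchhoffGutmanRatio where

  open RationalRingSolver
  open RationalArithmetic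
  open PrismDistance using (gutmanIndex)
  open PrismPotentials using (denominator; kirchhoffNumerator)
  open IndexPolynomials
  open PrismIndices
  open import Data.Integer as ℤ using (ℤ; +_; +[1+_]; -[1+_])
  open import Data.Nat as ℕ using (ℕ; suc; s≤s)
  import Data.Nat.Properties as ℕ
  open import Data.Nat.Coprimality using (Coprime)
  open import Data.Product using (Σ; _×_; _,_)
  open import Data.Rational as ℚ using (ℚ; mkℚ; 0ℚ; 1ℚ; _+_; _-_; _*_; _/_; _<_)
  import Data.Rational.Properties as ℚ
  open import Relation.Binary.PropositionalEquality

  module _ (k : ℕ) where

    private
      m : ℕ
      m = suc k
      G : Graph
      G = S²[ suc m ]
      open PrismResistance m

    deviation : ∀ r → IsResistanceFn G r →
                KfStar G r ÷' ℕ→ℚ (Gut G) - (+ 16) / 33 ≡ (+ deviationNumerator k) / deviationDenominator k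
    deviation r r-res = fraction-unique A (ℕ.pred (deviationDenominator k)) (begin
      (KfStar G r ÷' ℕ→ℚ (Gut G) - c) * ℕ→ℚ (deviationDenominator k)
        ≡⟨ cong₂ (λ x y → (x - c) * y) ratio (trans (ℕ→ℚ-* (33 ℕ.* D) g) (cong (_* ℕ→ℚ g) (ℕ→ℚ-* 33 D))) ⟩
      (s * w - c) * (ℕ→ℚ 33 * ℕ→ℚ D * ℕ→ℚ g)
        ≡⟨ regroup s w c (ℕ→ℚ 33) (ℕ→ℚ D) (ℕ→ℚ g) ⟩
      ℕ→ℚ 33 * (s * ℕ→ℚ D) * (ℕ→ℚ g * w) - c * ℕ→ℚ 33 * ℕ→ℚ D * ℕ→ℚ g
        ≡⟨ cong₂ (λ x y → ℕ→ℚ 33 * x * y - ℕ→ℚ 16 * ℕ→ℚ D * ℕ→ℚ g) (scale-*-denominator T) (ℕ→ℚ-inverse (ℕ.pred g)) ⟩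
      ℕ→ℚ 33 * ℕ→ℚ T * 1ℚ - ℕ→ℚ 16 * ℕ→ℚ D * ℕ→ℚ g
        ≡⟨ cong₂ _-_ (trans (ℚ.*-identityʳ _) (sym (ℕ→ℚ-* 33 T)))
                     (sym (trans (ℕ→ℚ-* (16 ℕ.* D) g) (cong (_* ℕ→ℚ g) (ℕ→ℚ-* 16 D)))) ⟩
      ℕ→ℚ (33 ℕ.* T) - ℕ→ℚ B
        ≡⟨ cong (λ x → ℕ→ℚ x - ℕ→ℚ B) (kirchhoffNumerator-split k) ⟩
      ℕ→ℚ (B ℕ.+ A) - ℕ→ℚ B
        ≡⟨ cong (_- ℕ→ℚ B) (ℕ→ℚ-+ B A) ⟩
      ℕ→ℚ B + ℕ→ℚ A - ℕ→ℚ B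
        ≡⟨ cancel (ℕ→ℚ B) (ℕ→ℚ A) ⟩
      ℕ→ℚ A ∎)
      where
      open ≡-Reasoning
      T g D A B : ℕ
      T = kirchhoffNumerator k
      g = gutmanIndex k
      D = denominator m
      A = deviationNumerator k
      B = 16 ℕ.* D ℕ.* g
      s c : ℚ
      s = scale T
      c = (+ 16) / 33
      w : ℚ
      w = (+ 1) / g
      ratio : KfStar G r ÷' ℕ→ℚ (Gut G) ≡ s * w
      ratio = trans (cong₂ _÷'_ (KfStar-prism k r r-res) (cong ℕ→ℚ (Gut-prism k)))
                    (÷'-by-inverse s (ℕ→ℚ g) w (ℕ→ℚ-inverse (ℕ.pred g)))
      regroup : ∀ s w c a b g → (s * w - c) * (a * b * g) ≡ a * (s * b) * (g * w) - c * a * b * g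
      regroup = solve-∀ ℚ-ring
      cancel : ∀ x y → x + y - x ≡ y
      cancel = solve-∀ ℚ-ring

  kirchhoffPolynomial : ℕ → ℤ
  kirchhoffPolynomial n = + 48 ℤ.* + n ℤ.* + n ℤ.* + n ℤ.+ + 25 ℤ.* + n ℤ.* + n ℤ.- + 180 ℤ.* + n ℤ.+ + 116

  kirchhoffPolynomial≡ : ∀ k → kirchhoffPolynomial (suc (suc k)) ≡ + kirchhoffNumerator k
  kirchhoffPolynomial≡ k =
    pos-balance (48 ℕ.* n ℕ.* n ℕ.* n ℕ.+ 25 ℕ.* n ℕ.* n) (180 ℕ.* n) 116 (kirchhoffNumerator k) (kirchhoffNumerator-cubic k)
    where
    n : ℕ
    n = suc (suc k)

  KfStar-formula : (n : ℕ) → 2 ℕ.≤ n →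
    (Σ (ResFn S²[ n ]) λ r → IsResistanceFn S²[ n ] r) ×
    (∀ r → IsResistanceFn S²[ n ] r → KfStar S²[ n ] r ≡ kirchhoffPolynomial n / (6 ℕ.+ 3 ℕ.* n))
  KfStar-formula (suc (suc k)) (s≤s (s≤s _)) =
    (effectiveResistance , effectiveResistance-isResistanceFn) , λ r r-res → begin
      KfStar S²[ suc (suc k) ] r                          ≡⟨ KfStar-prism k r r-res ⟩
      scale (kirchhoffNumerator k)                        ≡˘⟨ /-scale (kirchhoffNumerator k) ⟩
      + kirchhoffNumerator k / (6 ℕ.+ 3 ℕ.* suc (suc k))   ≡˘⟨ cong (_/ (6 ℕ.+ 3 ℕ.* suc (suc k))) (kirchhoffPolynomial≡ k) ⟩
      kirchhoffPolynomial (suc (suc k)) / (6 ℕ.+ 3 ℕ.* suc (suc k)) ∎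
    where
    open ≡-Reasoning
    open PrismResistance (suc k)

  kirchhoff-gutman-deviation : ∀ k p q .(c : Coprime (suc p) (suc q)) → q ℕ.≤ k →
    ∀ r → IsResistanceFn S²[ suc (suc k) ] r →
    ℚ.∣ KfStar S²[ suc (suc k) ] r ÷' ℕ→ℚ (Gut S²[ suc (suc k) ]) - (+ 16) / 33 ∣ < mkℚ +[1+ p ] q c
  kirchhoff-gutman-deviation k p q c q≤k r r-res =
    subst (_< mkℚ +[1+ p ] q c) (sym (trans (cong ℚ.∣_∣ (deviation k r r-res)) (ℚ.0≤p⇒∣p∣≡p nonNegative)))
          (/-<-mkℚ (deviationNumerator k) _ p q c (begin-strict
            deviationNumerator k ℕ.* suc q      ≤⟨ ℕ.*-monoʳ-≤ (deviationNumerator k) (s≤s q≤k) ⟩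
            deviationNumerator k ℕ.* suc k      <⟨ deviation-bound k ⟩
            deviationDenominator k      ≤⟨ ℕ.m≤n*m (deviationDenominator k) (suc p) ⟩
            suc p ℕ.* deviationDenominator k ∎))
    where
    open ℕ.≤-Reasoning
    nonNegative : 0ℚ ℚ.≤ (+ deviationNumerator k) / deviationDenominator k
    nonNegative = ℚ.nonNegative⁻¹ _ {{ℚ.normalize-nonNeg (deviationNumerator k) (deviationDenominator k)}}

  kirchhoff-gutman-limit : ∀ ε → 0ℚ < ε → Σ ℕ λ M → ∀ n → M ℕ.≤ n → 2 ℕ.≤ n → ∀ r → IsResistanceFn S²[ n ] r →
    ℚ.∣ KfStar S²[ n ] r ÷' ℕ→ℚ (Gut S²[ n ]) - (+ 16) / 33 ∣ < ε
  kirchhoff-gutman-limit (mkℚ (+ 0)     q c) (ℚ.*<* (ℤ.+<+ ()))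
  kirchhoff-gutman-limit (mkℚ -[1+ p ]  q c) (ℚ.*<* ())
  kirchhoff-gutman-limit (mkℚ +[1+ p ]  q c) _ = suc (suc q) , close
    where
    close : ∀ n → suc (suc q) ℕ.≤ n → 2 ℕ.≤ n → ∀ r → IsResistanceFn S²[ n ] r →
            ℚ.∣ KfStar S²[ n ] r ÷' ℕ→ℚ (Gut S²[ n ]) - (+ 16) / 33 ∣ < mkℚ +[1+ p ] q c
    close (suc (suc k)) (s≤s (s≤s q≤k)) _ = kirchhoff-gutman-deviation k p q c q≤k

open KirchhoffGutmanRatio using (KfStar-formula; kirchhoff-gutman-limit)
open import Data.Nat using (ℕ; _≥_)
import Data.Nat
open import Data.Integer using (+_; _-_; _+_; _*_)
open import Data.Rational using (ℚ; _/_; ∣_∣; _<_; 0ℚ) renaming (_-_ to _-ℚ_)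
open import Data.Product using (_×_; _,_; Σ)
open import Relation.Binary.PropositionalEquality using (_≡_)

theorem3p2 :
    -- (1) for n ≥ 2, a resistance-distance function exists and any such gives the formula
    ((n : ℕ) → n ≥ 2 →
      (Σ (ResFn S²[ n ]) λ r → IsResistanceFn S²[ n ] r)
      × (∀ r → IsResistanceFn S²[ n ] r →
          KfStar S²[ n ] r ≡
            ((+ 48 * + n * + n * + n + + 25 * + n * + n - + 180 * + n + + 116) / (6 Data.Nat.+ 3 Data.Nat.* n))))
    ×
    -- (2) lim_{n→∞} Kf*(S_n^2) / Gut(S_n^2) = 16/33
    (∀ (ε : ℚ) → 0ℚ < ε → Σ ℕ λ M → ∀ n → n ≥ M → n ≥ 2 → ∀ r → IsResistanceFn S²[ n ] r →
      ∣ (KfStar S²[ n ] r ÷' ℕ→ℚ (Gut S²[ n ])) -ℚ (+ 16 / 33) ∣ < ε)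
theorem3p2 = KfStar-formula , kirchhoff-gutman-limit
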